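{- Let $p$ be a prime and $n,k$ positive integers. Then $S(n,k)$ is a minimum zero case if and only if $S(np,kp)$ is a minimum zero case. Furthermore, if $S(n,k)$ is a minimum zero case, then $\nu_p(S(n,k))=\nu_p(S(np,kp))$ and $\epsilon_p(S(n,k))\equiv \epsilon_p(S(np,kp)) \pmod p$.
   Context: $S(n,k)$ is the Stirling number of the second kind. $\nu_p$ is the $p$-adic valuation, $\sigma_p(m)$ the base-$p$ digit sum, and $\epsilon_p(x)=p^{ -\nu_p(x)}x$ the unit part of a nonzero rational $x$. $S(n,k)$ is called a minimum zero case if $\nu_p(S(n,k)) = (\sigma_p(k)-\sigma_p(n))/(p-1)$. -}

module Defs where

open import Data.Nat using (ℕ; zero; suc; _+_; _*_; _∸_; _^_; _≤_; _<_; NonZero)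
open import Data.Nat.DivMod using (_/_; _%_)
open import Data.Nat.Divisibility using (_∣_)
import Data.Nat.Properties
open import Data.Integer using (ℤ; +_; _-_)
open import Data.Product using (_×_; ∃)
open import Relation.Nullary using (¬_)
open import Relation.Binary.PropositionalEquality using (_≡_; _≢_)

S : ℕ → ℕ → ℕ
S zero    zero    = 1
S zero    (suc k) = 0
S (suc n) zero    = 0
S (suc n) (suc k) = suc k * S n (suc k) + S n k

-- base-p digit sum (p ≥ 2). The fuel argument (≥ m suffices since m/p < m)
digitSumFuel : ℕ → (p : ℕ) → .{{NonZero p}} → ℕ → ℕ
digitSumFuel zero    p m = 0
digitSumFuel (suc f) p zero = 0
digitSumFuel (suc f) p m@(suc _) = m % p + digitSumFuel f p (m / p)

σ : (p : ℕ) → .{{NonZero p}} → ℕ → ℕ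
σ p m = digitSumFuel m p m

Val : ℕ → ℕ → ℕ → Set
Val p m v = m ≢ 0 × (p ^ v ∣ m) × ¬ (p ^ suc v ∣ m)

-- S(n,k) is a minimum zero case: ν_p(S(n,k)) = (σ_p(k) - σ_p(n))/(p-1),
-- i.e. S(n,k) ≠ 0 with valuation v and (p-1)·v = σ_p(k) - σ_p(n) in ℤ.
MinZero : (p : ℕ) → .{{NonZero p}} → ℕ → ℕ → Set
MinZero p n k = ∃ λ v → Val p (S n k) v × ((+ (p ∸ 1)) Data.Integer.* (+ v) ≡ (+ σ p k) - (+ σ p n))

-- unit part ε_p(m) = m / p^v where v = ν_p(m)
ε : (p : ℕ) → .{{NonZero p}} → ℕ → ℕ → ℕ
ε p m v = _/_ m (p ^ v) {{Data.Nat.Properties.m^n≢0 p v}}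

module Submission where

-- We show that S(n,k)
-- is a minimum zero case, ν_p(S(n,k)) = (σ_p(k) - σ_p(n))/(p-1), iff S(np,kp) is, with the
-- same valuation and unit parts congruent modulo p.  Everything rests on the congruence
--
--     (p-1)·m = σ_p(k) - σ_p(n)   ⇒   S(pn,pk) ≡ S(n,k)   (mod p^(m+1))          (S-scale)
--
-- because numbers congruent modulo p^(v+1) share a valuation v and have unit parts congruent
-- modulo p (valuation-transfer).  For S-scale we expand F(n,k) = k!·S(n,k) by its first block,
-- F(n,k+1) = Σ_b C(n,b)·F(b,k).  Kummer's theorem bounds the valuation of every term, and
-- modulo p^(L+1), where (p-1)·L = k - σ_p(n), only the ordered partitions into blocks whose
-- sizes are powers of p survive (leading-term):  F(n,k)·c!^M ≡ p^L·ε_p(n!)·Comp(n,k), with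
-- Comp(n,k) the number of compositions of n into k powers of p, c! = ε_p((p-1)!) and
-- (p-1)·M = n - k.  A Lucas-type argument gives Comp(pn,pk) ≡ Comp(n,k) (mod p) (Comp-scale),
-- and comparing the leading terms for (n,k) and (pn,pk) yields S-scale.
--
-- Throughout, p = q + 2 is prime.

open import Data.Nat using (ℕ; suc)
open import Data.Nat.Primality using (Prime)

module FiniteSum where

  open import Data.Nat as N using (ℕ; zero; suc; _≤_; _<_; _∸_)
  import Data.Nat.Properties as NP
  open import Data.Integer hiding (suc; _≤_; _<_)
  open import Data.Integer.Properties
  open import Data.Integer.Tactic.RingSolver using (solve-∀)
  open import Relation.Binary.PropositionalEquality
  open import Relation.Nullary using (Dec; yes; no; ¬_)
  open import Data.Empty using (⊥-elim)

  𝟙 : ∀ {P : Set} → Dec P → ℤ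
  𝟙 (yes _) = 1ℤ
  𝟙 (no  _) = 0ℤ

  𝟙-yes : ∀ {P : Set} (d : Dec P) → P → 𝟙 d ≡ 1ℤ
  𝟙-yes (yes _) _  = refl
  𝟙-yes (no ¬P) pf = ⊥-elim (¬P pf)

  𝟙-no : ∀ {P : Set} (d : Dec P) → ¬ P → 𝟙 d ≡ 0ℤ
  𝟙-no (yes pf) ¬P = ⊥-elim (¬P pf)
  𝟙-no (no _)   _  = refl

  Σ< : ℕ → (ℕ → ℤ) → ℤ
  Σ< zero    f = 0ℤ
  Σ< (suc n) f = Σ< n f + f n

  Σ-cong : ∀ n {f g} → (∀ i → i < n → f i ≡ g i) → Σ< n f ≡ Σ< n g
  Σ-cong zero    h = refl
  Σ-cong (suc n) h = cong₂ _+_ (Σ-cong n (λ i lt → h i (NP.m<n⇒m<1+n lt))) (h n NP.≤-refl)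

  Σ-zero : ∀ n f → (∀ i → i < n → f i ≡ 0ℤ) → Σ< n f ≡ 0ℤ
  Σ-zero n f h = trans (Σ-cong n h) (Σ-const0 n)
    where
      Σ-const0 : ∀ n → Σ< n (λ _ → 0ℤ) ≡ 0ℤ
      Σ-const0 zero    = refl
      Σ-const0 (suc n) = trans (+-identityʳ _) (Σ-const0 n)

  Σ-+ : ∀ n f g → Σ< n (λ i → f i + g i) ≡ Σ< n f + Σ< n g
  Σ-+ zero    f g = refl
  Σ-+ (suc n) f g = trans (cong (_+ (f n + g n)) (Σ-+ n f g)) (swap (Σ< n f) (Σ< n g) (f n) (g n))
    where swap : ∀ a b c d → a + b + (c + d) ≡ a + c + (b + d)
          swap = solve-∀

  Σ-*ˡ : ∀ n c f → Σ< n (λ i → c * f i) ≡ c * Σ< n f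
  Σ-*ˡ zero    c f = sym (*-zeroʳ c)
  Σ-*ˡ (suc n) c f = trans (cong (_+ c * f n) (Σ-*ˡ n c f)) (sym (*-distribˡ-+ c (Σ< n f) (f n)))

  Σ-*ʳ : ∀ n f c → Σ< n f * c ≡ Σ< n (λ i → f i * c)
  Σ-*ʳ n f c = trans (*-comm (Σ< n f) c) (trans (sym (Σ-*ˡ n c f)) (Σ-cong n (λ i _ → *-comm c (f i))))

  Σ-shift : ∀ n f → Σ< (suc n) f ≡ f 0 + Σ< n (λ i → f (suc i))
  Σ-shift zero    f = trans (+-identityˡ (f 0)) (sym (+-identityʳ (f 0)))
  Σ-shift (suc n) f = trans (cong (_+ f (suc n)) (Σ-shift n f)) (+-assoc (f 0) _ _)

  Σ-split : ∀ a b f → Σ< (a N.+ b) f ≡ Σ< a f + Σ< b (λ r → f (a N.+ r))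
  Σ-split a zero    f = trans (cong (λ z → Σ< z f) (NP.+-identityʳ a)) (sym (+-identityʳ _))
  Σ-split a (suc b) f = trans (cong (λ z → Σ< z f) (NP.+-suc a b))
                              (trans (cong (_+ f (a N.+ b)) (Σ-split a b f)) (+-assoc (Σ< a f) _ _))

  Σ-swap : ∀ n K (f : ℕ → ℕ → ℤ) → Σ< n (λ b → Σ< K (λ i → f i b)) ≡ Σ< K (λ i → Σ< n (λ b → f i b))
  Σ-swap zero    K f = sym (Σ-zero K _ (λ _ _ → refl))
  Σ-swap (suc n) K f = trans (cong (_+ Σ< K (λ i → f i n)) (Σ-swap n K f))
                             (sym (Σ-+ K (λ i → Σ< n (λ b → f i b)) (λ i → f i n)))

  Σ-drop : ∀ n i g → (∀ b → b < i → g b ≡ 0ℤ) → Σ< n g ≡ Σ< (n ∸ i) (λ b' → g (i N.+ b'))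
  Σ-drop n i g h with i N.≤? n
  ... | yes i≤n = begin
    Σ< n g                                            ≡⟨ cong (λ z → Σ< z g) (sym (NP.m+[n∸m]≡n i≤n)) ⟩
    Σ< (i N.+ (n ∸ i)) g                              ≡⟨ Σ-split i (n ∸ i) g ⟩
    Σ< i g + Σ< (n ∸ i) (λ b' → g (i N.+ b'))         ≡⟨ cong (_+ Σ< (n ∸ i) (λ b' → g (i N.+ b'))) (Σ-zero i g h) ⟩
    0ℤ + Σ< (n ∸ i) (λ b' → g (i N.+ b'))             ≡⟨ +-identityˡ _ ⟩
    Σ< (n ∸ i) (λ b' → g (i N.+ b')) ∎
    where open ≡-Reasoning
  ... | no i≰n = trans (Σ-zero n g (λ b lt → h b (NP.<-trans lt (NP.≰⇒> i≰n))))
                       (cong (λ z → Σ< z (λ b' → g (i N.+ b'))) (sym (NP.m≤n⇒m∸n≡0 (NP.<⇒≤ (NP.≰⇒> i≰n)))))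

module Binomial where

  open import Data.Nat as N using (ℕ; suc; _≤_; _<_; s≤s; _!; _∸_)
  import Data.Nat.Properties as NP
  open import Data.Nat.DivMod using (m/n*n≡m)
  open import Data.Nat.Combinatorics using (_C_; nCk+nC[k+1]≡[n+1]C[k+1]; k>n⇒nCk≡0; k![n∸k]!∣n!)
  open import Data.Nat.Combinatorics.Specification using (nCk≡n!/k![n-k]!)
  open import Data.Integer hiding (suc; _≤_; _<_)
  open import Data.Integer.Properties
  open import Data.Integer.Tactic.RingSolver using (solve-∀)
  import Data.Nat.Tactic.RingSolver as NS
  open import Relation.Binary.PropositionalEquality
  open FiniteSum

  pascal : ∀ n k → suc n C suc k ≡ n C k N.+ n C suc k
  pascal n k = sym (nCk+nC[k+1]≡[n+1]C[k+1] n k)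

  binomial-factorial : ∀ n k → k ≤ n → (n C k) N.* (k ! N.* (n ∸ k) !) ≡ n !
  binomial-factorial n k le =
    trans (cong (N._* (k ! N.* (n ∸ k) !)) (nCk≡n!/k![n-k]! le)) (m/n*n≡m {{_}} (k![n∸k]!∣n! le))

  absorption : ∀ n i → i ≤ n → (suc n C suc i) N.* suc i ≡ suc n N.* (n C i)
  absorption n i le = NP.*-cancelʳ-≡ _ _ (i ! N.* (n ∸ i) !) {{NP.m*n≢0 _ _ {{i NP.!≢0}} {{(n ∸ i) NP.!≢0}}}} (begin
      (suc n C suc i) N.* suc i N.* (i ! N.* (n ∸ i) !)   ≡⟨ reassoc (suc n C suc i) (suc i) (i !) ((n ∸ i) !) ⟩
      (suc n C suc i) N.* (suc i N.* i ! N.* (n ∸ i) !)   ≡⟨ binomial-factorial (suc n) (suc i) (s≤s le) ⟩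
      suc n N.* n !                                       ≡⟨ cong (suc n N.*_) (sym (binomial-factorial n i le)) ⟩
      suc n N.* ((n C i) N.* (i ! N.* (n ∸ i) !))         ≡⟨ sym (NP.*-assoc (suc n) (n C i) _) ⟩
      suc n N.* (n C i) N.* (i ! N.* (n ∸ i) !) ∎)
    where
      open ≡-Reasoning
      reassoc : ∀ x y z t → x N.* y N.* (z N.* t) ≡ x N.* (y N.* z N.* t)
      reassoc = NS.solve-∀

  Σ-pascal : ∀ n (g : ℕ → ℤ) →
    Σ< (suc (suc n)) (λ b → + (suc n C b) * g b)
      ≡ Σ< (suc n) (λ b → + (n C b) * g b) + Σ< (suc n) (λ b → + (n C b) * g (suc b))
  Σ-pascal n g = begin
      Σ< (suc (suc n)) (λ b → + (suc n C b) * g b)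
        ≡⟨ Σ-shift (suc n) _ ⟩
      + 1 * g 0 + Σ< (suc n) (λ b → + (suc n C suc b) * g (suc b))
        ≡⟨ cong (λ z → + 1 * g 0 + z) (trans (Σ-cong (suc n) (λ b _ → split b)) (Σ-+ (suc n) A B)) ⟩
      + 1 * g 0 + (Σ< (suc n) A + (Σ< n B + + (n C suc n) * g (suc n)))
        ≡⟨ cong (λ z → + 1 * g 0 + (Σ< (suc n) A + (Σ< n B + + z * g (suc n)))) (k>n⇒nCk≡0 {n} {suc n} NP.≤-refl) ⟩
      + 1 * g 0 + (Σ< (suc n) A + (Σ< n B + 0ℤ * g (suc n)))
        ≡⟨ regroup (+ 1 * g 0) (Σ< (suc n) A) (Σ< n B) (g (suc n)) ⟩
      (+ 1 * g 0 + Σ< n B) + Σ< (suc n) A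
        ≡⟨ cong (_+ Σ< (suc n) A) (sym (Σ-shift n (λ b → + (n C b) * g b))) ⟩
      Σ< (suc n) (λ b → + (n C b) * g b) + Σ< (suc n) A ∎
    where
      open ≡-Reasoning
      A B : ℕ → ℤ
      A b = + (n C b) * g (suc b)
      B b = + (n C suc b) * g (suc b)
      split : ∀ b → + (suc n C suc b) * g (suc b) ≡ A b + B b
      split b = trans (cong (λ z → + z * g (suc b)) (pascal n b))
                      (trans (cong (_* g (suc b)) (pos-+ (n C b) (n C suc b))) (*-distribʳ-+ (g (suc b)) (+ (n C b)) (+ (n C suc b))))
      regroup : ∀ x a b y → x + (a + (b + 0ℤ * y)) ≡ (x + b) + a
      regroup = solve-∀

module Stirling where

  open import Defs using (S)
  open import Data.Nat as N using (ℕ; zero; suc; _≤_; _<_; s≤s; _!)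
  import Data.Nat.Properties as NP
  open import Data.Nat.Combinatorics using (_C_; nCn≡1)
  open import Data.Integer hiding (suc; _≤_; _<_)
  open import Data.Integer.Properties
  open import Data.Integer.Tactic.RingSolver using (solve-∀)
  import Data.Nat.Tactic.RingSolver as NS
  open import Relation.Binary.PropositionalEquality
  open FiniteSum
  open Binomial

  S-vanishes : ∀ k n → n < k → S n k ≡ 0
  S-vanishes (suc k) zero    _ = refl
  S-vanishes (suc k) (suc n) (s≤s n<k)
    rewrite S-vanishes (suc k) n (NP.m<n⇒m<1+n n<k) | S-vanishes k n n<k =
      trans (NP.+-identityʳ (suc k N.* 0)) (NP.*-zeroʳ (suc k))

  -- Choosing the block of the element n+1: S(n+1,k+1) = Σ_{b≤n} C(n,b) S(b,k).
  S-binomial : ∀ n k → + S (suc n) (suc k) ≡ Σ< (suc n) (λ b → + (n C b) * + S b k)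
  S-binomial zero k =
    trans (cong (λ z → + (z N.+ S 0 k)) (NP.*-zeroʳ (suc k))) (sym (trans (+-identityˡ _) (*-identityˡ _)))
  S-binomial (suc n) zero = begin
      + S (suc (suc n)) 1
        ≡⟨ cong +_ (trans (cong (N._+ 0) (NP.*-identityˡ (S (suc n) 1))) (NP.+-identityʳ _)) ⟩
      + S (suc n) 1
        ≡⟨ S-binomial n zero ⟩
      Σ< (suc n) (λ b → + (n C b) * + S b 0)
        ≡⟨ sym (+-identityʳ _) ⟩
      Σ< (suc n) (λ b → + (n C b) * + S b 0) + 0ℤ
        ≡⟨ cong (λ z → Σ< (suc n) (λ b → + (n C b) * + S b 0) + z) (sym (Σ-zero (suc n) _ (λ i _ → *-zeroʳ (+ (n C i))))) ⟩
      Σ< (suc n) (λ b → + (n C b) * + S b 0) + Σ< (suc n) (λ b → + (n C b) * + S (suc b) 0)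
        ≡⟨ sym (Σ-pascal n (λ b → + S b 0)) ⟩
      Σ< (suc (suc n)) (λ b → + (suc n C b) * + S b 0) ∎
    where open ≡-Reasoning
  S-binomial (suc n) (suc k) = begin
      + S (suc (suc n)) (suc (suc k))
        ≡⟨ S-step (suc (suc k)) (S (suc n) (suc (suc k))) (S (suc n) (suc k)) ⟩
      + suc (suc k) * X + Y
        ≡⟨ peel (+ suc k) X Y ⟩
      X + (+ suc k * X + Y)
        ≡⟨ cong₂ (λ u v → u + (+ suc k * u + v)) (S-binomial n (suc k)) (S-binomial n k) ⟩
      ΣA + (+ suc k * ΣA + Σ< (suc n) (λ b → + (n C b) * + S b k))
        ≡⟨ cong (λ z → ΣA + z) (sym (trans (Σ-+ (suc n) _ _) (cong (_+ Σ< (suc n) (λ b → + (n C b) * + S b k)) (Σ-*ˡ (suc n) (+ suc k) _)))) ⟩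
      ΣA + Σ< (suc n) (λ b → + suc k * (+ (n C b) * + S b (suc k)) + + (n C b) * + S b k)
        ≡⟨ cong (λ z → ΣA + z) (Σ-cong (suc n) (λ b _ → trans (factor (+ suc k) (+ (n C b)) (+ S b (suc k)) (+ S b k))
                                                      (cong (+ (n C b) *_) (sym (S-step (suc k) (S b (suc k)) (S b k)))))) ⟩
      ΣA + Σ< (suc n) (λ b → + (n C b) * + S (suc b) (suc k))
        ≡⟨ sym (Σ-pascal n (λ b → + S b (suc k))) ⟩
      Σ< (suc (suc n)) (λ b → + (suc n C b) * + S b (suc k)) ∎
    where
      open ≡-Reasoning
      X Y ΣA : ℤ
      X = + S (suc n) (suc (suc k))
      Y = + S (suc n) (suc k)
      ΣA = Σ< (suc n) (λ b → + (n C b) * + S b (suc k))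
      S-step : ∀ c x y → + (c N.* x N.+ y) ≡ + c * + x + + y
      S-step c x y = trans (pos-+ (c N.* x) y) (cong (_+ + y) (pos-* c x))
      peel : ∀ c x y → (+ 1 + c) * x + y ≡ x + (c * x + y)
      peel = solve-∀
      factor : ∀ c a x y → c * (a * x) + a * y ≡ a * (c * x + y)
      factor = solve-∀

  -- F(n,k) = k!·S(n,k) counts ordered partitions (surjections onto k labelled blocks).
  F : ℕ → ℕ → ℕ
  F n k = k ! N.* S n k

  F-vanishes : ∀ k n → n < k → F n k ≡ 0
  F-vanishes k n lt rewrite S-vanishes k n lt = NP.*-zeroʳ (k !)

  -- Choosing the first block: F(n,k+1) = Σ_{b<n} C(n,b) F(b,k).
  F-binomial : ∀ n k → + F n (suc k) ≡ Σ< n (λ b → + (n C b) * + F b k)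
  F-binomial n k = begin
      + F n (suc k)
        ≡⟨ cong +_ (trans (NP.*-assoc (suc k) (k !) (S n (suc k))) (swapℕ (suc k) (k !) (S n (suc k)))) ⟩
      + (k ! N.* (suc k N.* S n (suc k)))
        ≡⟨ pos-* (k !) _ ⟩
      + (k !) * + (suc k N.* S n (suc k))
        ≡⟨ cong (+ (k !) *_) without-last ⟩
      + (k !) * Σ< n (λ b → + (n C b) * + S b k)
        ≡⟨ sym (Σ-*ˡ n (+ (k !)) _) ⟩
      Σ< n (λ b → + (k !) * (+ (n C b) * + S b k))
        ≡⟨ Σ-cong n (λ b _ → trans (swap (+ (k !)) (+ (n C b)) (+ S b k)) (cong (+ (n C b) *_) (sym (pos-* (k !) (S b k))))) ⟩
      Σ< n (λ b → + (n C b) * + F b k) ∎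
    where
      open ≡-Reasoning
      swapℕ : ∀ a b c → a N.* (b N.* c) ≡ b N.* (a N.* c)
      swapℕ = NS.solve-∀
      swap : ∀ a b c → a * (b * c) ≡ b * (a * c)
      swap = solve-∀
      cancelʳ : ∀ a b c → a + c ≡ b + c → a ≡ b
      cancelʳ a b c e = trans (add-sub a c) (trans (cong (_- c) e) (sym (add-sub b c)))
        where add-sub : ∀ a c → a ≡ a + c - c
              add-sub = solve-∀
      -- S-binomial with its last term (b = n, which is S(n,k) itself) removed
      without-last : + (suc k N.* S n (suc k)) ≡ Σ< n (λ b → + (n C b) * + S b k)
      without-last = cancelʳ _ _ (+ S n k) (begin
          + (suc k N.* S n (suc k)) + + S n k                  ≡⟨ sym (pos-+ (suc k N.* S n (suc k)) (S n k)) ⟩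
          + S (suc n) (suc k)                                  ≡⟨ S-binomial n k ⟩
          Σ< n (λ b → + (n C b) * + S b k) + + (n C n) * + S n k ≡⟨ cong (λ z → Σ< n (λ b → + (n C b) * + S b k) + + z * + S n k) (nCn≡1 n) ⟩
          Σ< n (λ b → + (n C b) * + S b k) + + 1 * + S n k      ≡⟨ cong (λ z → Σ< n (λ b → + (n C b) * + S b k) + z) (*-identityˡ (+ S n k)) ⟩
          Σ< n (λ b → + (n C b) * + S b k) + + S n k ∎)

module DigitSum (q : ℕ) where

  open import Defs using (σ; digitSumFuel)
  open import Data.Nat
  open import Data.Nat.Properties
  open import Data.Nat.DivMod
  open import Data.Nat.Divisibility using (divides)
  open import Data.Nat.Induction using (<-rec)
  open import Relation.Binary.PropositionalEquality

  p : ℕ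
  p = suc (suc q)

  σp : ℕ → ℕ
  σp = σ p

  /p< : ∀ m → .{{NonZero m}} → m / p < m
  /p< m = m/n<m m p (s≤s (s≤s z≤n))

  digits : ∀ m → m ≡ m % p + p * (m / p)
  digits m = trans (m≡m%n+[m/n]*n m p) (cong (m % p +_) (*-comm (m / p) p))

  digitSumFuel-irrelevant : ∀ f g m → m ≤ f → m ≤ g → digitSumFuel f p m ≡ digitSumFuel g p m
  digitSumFuel-irrelevant zero    zero    zero _ _ = refl
  digitSumFuel-irrelevant zero    (suc g) zero _ _ = refl
  digitSumFuel-irrelevant (suc f) zero    zero _ _ = refl
  digitSumFuel-irrelevant (suc f) (suc g) zero _ _ = refl
  digitSumFuel-irrelevant (suc f) (suc g) (suc m) (s≤s m≤f) (s≤s m≤g) =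
    cong (suc m % p +_) (digitSumFuel-irrelevant f g (suc m / p) (≤-trans smaller m≤f) (≤-trans smaller m≤g))
    where smaller : suc m / p ≤ m
          smaller = ≤-pred (/p< (suc m))

  σ-unfold : ∀ m → σp m ≡ m % p + σp (m / p)
  σ-unfold zero    = cong σp (sym (0/n≡0 p))
  σ-unfold (suc m) =
    cong (suc m % p +_) (digitSumFuel-irrelevant m (suc m / p) (suc m / p) (≤-pred (/p< (suc m))) ≤-refl)

  digit-% : ∀ r t → r < p → (r + p * t) % p ≡ r
  digit-% r t r<p = trans (cong (λ z → (r + z) % p) (*-comm p t)) (trans ([m+kn]%n≡m%n r t p) (m<n⇒m%n≡m r<p))

  digit-/ : ∀ r t → r < p → (r + p * t) / p ≡ t
  digit-/ r t r<p = begin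
    (r + p * t) / p     ≡⟨ +-distrib-/-∣ʳ r (divides t (*-comm p t)) ⟩
    r / p + p * t / p   ≡⟨ cong₂ _+_ (m<n⇒m/n≡0 r<p) (trans (cong (_/ p) (*-comm p t)) (m*n/n≡m t p)) ⟩
    t ∎
    where open ≡-Reasoning

  σ-digit : ∀ r t → r < p → σp (r + p * t) ≡ r + σp t
  σ-digit r t r<p = trans (σ-unfold (r + p * t)) (cong₂ (λ a b → a + σp b) (digit-% r t r<p) (digit-/ r t r<p))

  σ-p* : ∀ t → σp (p * t) ≡ σp t
  σ-p* t = σ-digit 0 t (s≤s z≤n)

  σ-one : σp 1 ≡ 1
  σ-one = trans (cong σp (cong suc (sym (*-zeroʳ p)))) (σ-digit 1 0 (s≤s (s≤s z≤n)))

  σ≡0⇒≡0 : ∀ t → σp t ≡ 0 → t ≡ 0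
  σ≡0⇒≡0 = <-rec _ step
    where
      step : ∀ t → (∀ {s} → s < t → σp s ≡ 0 → s ≡ 0) → σp t ≡ 0 → t ≡ 0
      step zero    _  _   = refl
      step t@(suc _) ih σt≡0 =
        trans (digits t) (trans (cong₂ (λ a b → a + p * b) last≡0 rest≡0) (*-zeroʳ p))
        where
          σ-split : t % p + σp (t / p) ≡ 0
          σ-split = trans (sym (σ-unfold t)) σt≡0
          last≡0 : t % p ≡ 0
          last≡0 = m+n≡0⇒m≡0 (t % p) σ-split
          rest≡0 : t / p ≡ 0
          rest≡0 = ih (/p< t) (m+n≡0⇒n≡0 (t % p) σ-split)

  σ-positive : ∀ a → 1 ≤ a → 1 ≤ σp a
  σ-positive a 1≤a with σp a in σa
  ... | zero  = subst (1 ≤_) (σ≡0⇒≡0 a σa) 1≤a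
  ... | suc _ = s≤s z≤n

module Valuation (q : ℕ) (pr : Prime (suc (suc q))) where

  open import Data.Nat
  open import Data.Nat.Properties
  open import Data.Nat.DivMod
  open import Data.Nat.Divisibility
  open import Data.Nat.Primality using (euclidsLemma)
  open import Data.Product using (_×_; _,_; proj₁; proj₂)
  open import Data.Sum using (inj₁; inj₂)
  open import Data.Empty using (⊥-elim)
  open import Relation.Nullary using (¬_; yes; no)
  open import Relation.Binary.PropositionalEquality
  open DigitSum q public

  Factorisation : ℕ → ℕ → ℕ → Set
  Factorisation x v u = x ≡ p ^ v * u × ¬ p ∣ u

  strip : (f x : ℕ) → ℕ × ℕ
  strip zero    x       = 0 , x
  strip (suc f) zero    = 0 , 0
  strip (suc f) (suc x) with p ∣? suc x
  ... | yes _ = let r = strip f (suc x / p) in suc (proj₁ r) , proj₂ r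
  ... | no  _ = 0 , suc x

  -- ν_p(x) and ε_p(x); x itself is enough fuel.
  νp εp : ℕ → ℕ
  νp x = proj₁ (strip x x)
  εp x = proj₂ (strip x x)

  strip-factorises : ∀ f x → x ≤ f → x ≢ 0 → Factorisation x (proj₁ (strip f x)) (proj₂ (strip f x))
  strip-factorises f       zero    _ x≢0 = ⊥-elim (x≢0 refl)
  strip-factorises (suc f) (suc x) (s≤s x≤f) _ with p ∣? suc x
  ... | no p∤x = sym (*-identityˡ (suc x)) , p∤x
  ... | yes p∣x = trans x≡py (trans (cong (p *_) (proj₁ ih)) (sym (*-assoc p (p ^ proj₁ r) (proj₂ r)))) , proj₂ ih
    where
      y : ℕ
      y = suc x / p
      r : ℕ × ℕ
      r = strip f y
      x≡py : suc x ≡ p * y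
      x≡py = sym (m*[n/m]≡n p∣x)
      y≢0 : y ≢ 0
      y≢0 y≡0 with () ← trans x≡py (trans (cong (p *_) y≡0) (*-zeroʳ p))
      ih : Factorisation y (proj₁ r) (proj₂ r)
      ih = strip-factorises f y (≤-pred (≤-trans (/p< (suc x)) (s≤s x≤f))) y≢0

  factorisation : ∀ x → .{{NonZero x}} → Factorisation x (νp x) (εp x)
  factorisation x = strip-factorises x x ≤-refl (≢-nonZero⁻¹ x)

  factorisation-unique : ∀ v v' u u' → p ^ v * u ≡ p ^ v' * u' → ¬ p ∣ u → ¬ p ∣ u' → v ≡ v' × u ≡ u'
  factorisation-unique zero zero u u' e _ _ =
    refl , trans (sym (*-identityˡ u)) (trans e (*-identityˡ u'))
  factorisation-unique zero (suc v') u u' e p∤u _ =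
    ⊥-elim (p∤u (divides (p ^ v' * u') (trans (sym (*-identityˡ u)) (trans e (trans (*-assoc p (p ^ v') u') (*-comm p (p ^ v' * u')))))))
  factorisation-unique (suc v) zero u u' e _ p∤u' =
    ⊥-elim (p∤u' (divides (p ^ v * u) (trans (sym (*-identityˡ u')) (trans (sym e) (trans (*-assoc p (p ^ v) u) (*-comm p (p ^ v * u)))))))
  factorisation-unique (suc v) (suc v') u u' e p∤u p∤u'
    with factorisation-unique v v' u u' (*-cancelˡ-≡ _ _ p (trans (sym (*-assoc p (p ^ v) u)) (trans e (*-assoc p (p ^ v') u')))) p∤u p∤u'
  ... | v≡v' , u≡u' = cong suc v≡v' , u≡u'

  factorisation⇒νε : ∀ x v u → Factorisation x v u → νp x ≡ v × εp x ≡ u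
  factorisation⇒νε x v u (x≡ , p∤u) =
    factorisation-unique (νp x) v (εp x) u (trans (sym (proj₁ fx)) x≡) (proj₂ fx) p∤u
    where
      u≢0 : u ≢ 0
      u≢0 refl = p∤u (p ∣0)
      instance
        x-nonzero : NonZero x
        x-nonzero = subst NonZero (sym x≡) (m*n≢0 (p ^ v) u {{m^n≢0 p v}} {{≢-nonZero u≢0}})
      fx : Factorisation x (νp x) (εp x)
      fx = factorisation x

  p∤-* : ∀ u u' → ¬ p ∣ u → ¬ p ∣ u' → ¬ p ∣ (u * u')
  p∤-* u u' p∤u p∤u' p∣uu' with euclidsLemma u u' pr p∣uu'
  ... | inj₁ p∣u  = p∤u p∣u
  ... | inj₂ p∣u' = p∤u' p∣u'

  factorisation-* : ∀ {x y v u v' u'} → Factorisation x v u → Factorisation y v' u' →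
                    Factorisation (x * y) (v + v') (u * u')
  factorisation-* {v = v} {u} {v'} {u'} (refl , p∤u) (refl , p∤u') = regroup , p∤-* u u' p∤u p∤u'
    where
      regroup : p ^ v * u * (p ^ v' * u') ≡ p ^ (v + v') * (u * u')
      regroup = begin
        p ^ v * u * (p ^ v' * u')   ≡⟨ *-assoc (p ^ v) u _ ⟩
        p ^ v * (u * (p ^ v' * u')) ≡⟨ cong (p ^ v *_) (x∙yz≈y∙xz u (p ^ v') u') ⟩
        p ^ v * (p ^ v' * (u * u')) ≡⟨ sym (*-assoc (p ^ v) _ _) ⟩
        p ^ v * p ^ v' * (u * u')   ≡⟨ cong (_* (u * u')) (sym (^-distribˡ-+-* p v v')) ⟩
        p ^ (v + v') * (u * u') ∎
        where open ≡-Reasoning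
              open import Algebra.Properties.CommutativeSemigroup *-commutativeSemigroup using (x∙yz≈y∙xz)

  factorisation-unit : ∀ x → ¬ p ∣ x → Factorisation x 0 x
  factorisation-unit x p∤x = sym (*-identityˡ x) , p∤x

  factorisation-p* : ∀ {x v u} → Factorisation x v u → Factorisation (p * x) (suc v) u
  factorisation-p* {v = v} {u} (refl , p∤u) = sym (*-assoc p (p ^ v) u) , p∤u

  νε-* : ∀ x y → .{{NonZero x}} → .{{NonZero y}} → νp (x * y) ≡ νp x + νp y × εp (x * y) ≡ εp x * εp y
  νε-* x y = factorisation⇒νε (x * y) (νp x + νp y) (εp x * εp y)
               (factorisation-* {v = νp x} {εp x} {νp y} {εp y} (factorisation x) (factorisation y))

  ν-* : ∀ x y → .{{NonZero x}} → .{{NonZero y}} → νp (x * y) ≡ νp x + νp y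
  ν-* x y = proj₁ (νε-* x y)

  ε-* : ∀ x y → .{{NonZero x}} → .{{NonZero y}} → εp (x * y) ≡ εp x * εp y
  ε-* x y = proj₂ (νε-* x y)

  p∤ε : ∀ x → .{{NonZero x}} → ¬ p ∣ εp x
  p∤ε x = proj₂ (factorisation x)

  ν-p* : ∀ x → .{{NonZero x}} → νp (p * x) ≡ suc (νp x)
  ν-p* x = proj₁ (factorisation⇒νε (p * x) (suc (νp x)) (εp x) (factorisation-p* {v = νp x} (factorisation x)))

  ε-p* : ∀ x → .{{NonZero x}} → εp (p * x) ≡ εp x
  ε-p* x = proj₂ (factorisation⇒νε (p * x) (suc (νp x)) (εp x) (factorisation-p* {v = νp x} (factorisation x)))

  ν-unit : ∀ x → ¬ p ∣ x → νp x ≡ 0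
  ν-unit x p∤x = proj₁ (factorisation⇒νε x 0 x (factorisation-unit x p∤x))

  ε-unit : ∀ x → ¬ p ∣ x → εp x ≡ x
  ε-unit x p∤x = proj₂ (factorisation⇒νε x 0 x (factorisation-unit x p∤x))

  p∤1 : ¬ p ∣ 1
  p∤1 p∣1 with () ← ∣1⇒≡1 p∣1

  p∤digit : ∀ r t → 0 < r → r < p → ¬ p ∣ (r + p * t)
  p∤digit (suc r) t _ r<p p∣ with () ← trans (sym (digit-% (suc r) t r<p)) (n∣m⇒m%n≡0 _ p p∣)

-- The link between ν_p and σ_p: adding 1 to a raises the digit sum by one, except that
-- each carry (one per factor p of a + 1) turns a digit p - 1 into 0.
module ValuationDigitSum (q : ℕ) (pr : Prime (suc (suc q))) where

  open import Data.Nat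
  open import Data.Nat.Properties
  open import Data.Nat.DivMod using (m%n<n)
  open import Data.Nat.Divisibility using (_∣_)
  open import Data.Nat.Induction using (<-rec)
  open import Relation.Nullary using (¬_)
  open import Relation.Binary.PropositionalEquality
  import Data.Nat.Tactic.RingSolver as NS
  open Valuation q pr public

  SuccessorLaw : ℕ → Set
  SuccessorLaw a = σp (suc a) + suc q * νp (suc a) ≡ σp a + 1

  -- If the last digit of a + 1 is nonzero there is no carry, and p ∤ a + 1.
  successor-no-carry : ∀ a r t → suc r < p → suc a ≡ suc r + p * t → SuccessorLaw a
  successor-no-carry a r t r<p eq = begin
      σp (suc a) + suc q * νp (suc a)   ≡⟨ cong₂ (λ x y → σp x + suc q * y) eq (ν-unit (suc a) p∤a+1) ⟩
      σp (suc r + p * t) + suc q * 0    ≡⟨ cong₂ _+_ (σ-digit (suc r) t r<p) (*-zeroʳ (suc q)) ⟩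
      suc r + σp t + 0                  ≡⟨ +-identityʳ _ ⟩
      suc (r + σp t)                    ≡⟨ cong suc (sym (σ-digit r t (<-trans (n<1+n r) r<p))) ⟩
      suc (σp (r + p * t))              ≡⟨ cong (λ x → suc (σp x)) (sym (suc-injective eq)) ⟩
      suc (σp a)                        ≡⟨ +-comm 1 (σp a) ⟩
      σp a + 1 ∎
    where open ≡-Reasoning
          p∤a+1 : ¬ p ∣ suc a
          p∤a+1 = subst (λ z → ¬ p ∣ z) (sym eq) (p∤digit (suc r) t (s≤s z≤n) r<p)

  -- If a + 1 = p·(t + 1), then a ends in the digit p - 1 and ν_p(a+1) = ν_p(t+1) + 1,
  -- so the law for a follows from the law for t.
  successor-carry : ∀ a t → suc a ≡ p * suc t → SuccessorLaw t → SuccessorLaw a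
  successor-carry a t eq law-t = begin
      σp (suc a) + suc q * νp (suc a)              ≡⟨ cong (λ x → σp x + suc q * νp x) eq ⟩
      σp (p * suc t) + suc q * νp (p * suc t)      ≡⟨ cong₂ (λ x y → x + suc q * y) (σ-p* (suc t)) (ν-p* (suc t)) ⟩
      σp (suc t) + suc q * suc (νp (suc t))        ≡⟨ regroup (σp (suc t)) (suc q) (νp (suc t)) ⟩
      (σp (suc t) + suc q * νp (suc t)) + suc q    ≡⟨ cong (_+ suc q) law-t ⟩
      σp t + 1 + suc q                             ≡⟨ regroup′ (σp t) (suc q) ⟩
      suc q + σp t + 1                             ≡⟨ cong (_+ 1) (sym (σ-digit (suc q) t ≤-refl)) ⟩
      σp (suc q + p * t) + 1                       ≡⟨ cong (λ x → σp x + 1) (sym (suc-injective (trans eq (*-suc p t)))) ⟩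
      σp a + 1 ∎
    where
      open ≡-Reasoning
      regroup : ∀ x c v → x + c * suc v ≡ x + c * v + c
      regroup = NS.solve-∀
      regroup′ : ∀ x c → x + 1 + c ≡ c + x + 1
      regroup′ = NS.solve-∀

  σ-ν-successor : ∀ a → SuccessorLaw a
  σ-ν-successor = <-rec _ λ a ih → by-last-digit a ih (suc a % p) (suc a / p) (m%n<n (suc a) p) (digits (suc a))
    where
      by-last-digit : ∀ a → (∀ {b} → b < a → SuccessorLaw b) → ∀ r t → r < p → suc a ≡ r + p * t → SuccessorLaw a
      by-last-digit a _  (suc r) t r<p eq = successor-no-carry a r t r<p eq
      by-last-digit a _  zero zero    _ eq with () ← trans eq (*-zeroʳ p)
      by-last-digit a ih zero (suc t) _ eq = successor-carry a t eq (ih t<a)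
        where
          t<a : t < a
          t<a = subst (t <_) (sym (suc-injective (trans eq (*-suc p t)))) (s≤s (≤-trans (m≤n*m t p) (m≤n+m (p * t) q)))

-- Congruences of integers modulo powers of p: Cg j x y means x ≡ y (mod p^j).
module Congruence (q : ℕ) (pr : Prime (suc (suc q))) where

  open import Data.Nat as N using (ℕ; zero; suc; _≤_; _<_; _%_)
  import Data.Nat.Properties as NP
  import Data.Nat.Divisibility as ND
  open import Data.Nat.DivMod using (%-remove-+ʳ)
  open import Data.Nat.Primality using (euclidsLemma)
  open import Data.Integer hiding (suc; _≤_; _<_; _%_)
  open import Data.Integer.Properties
  open import Data.Integer.Divisibility.Signed as ZD using (_∣_; divides)
  open import Data.Integer.Tactic.RingSolver using (solve-∀)
  open import Data.Sum using (inj₁; inj₂)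
  open import Data.Empty using (⊥-elim)
  open import Relation.Nullary using (¬_)
  open import Relation.Binary.PropositionalEquality
  open ValuationDigitSum q pr public
  open FiniteSum using (Σ<)

  P^ : ℕ → ℤ
  P^ j = + (p N.^ j)

  P^-+ : ∀ a b → P^ (a N.+ b) ≡ P^ a * P^ b
  P^-+ a b = trans (cong +_ (NP.^-distribˡ-+-* p a b)) (pos-* (p N.^ a) (p N.^ b))

  P^-nonZero : ∀ {j} → NonZero (P^ j)
  P^-nonZero {j} = record { nonZero = N.NonZero.nonZero (NP.m^n≢0 p j) }

  -- A record rather than a plain definition, so that j, x and y can be inferred.
  record Cg (j : ℕ) (x y : ℤ) : Set where
    constructor mk-cg
    field divisibility : P^ j ∣ x - y

  cg-≡ : ∀ {j x y} → x ≡ y → Cg j x y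
  cg-≡ {j} {x} refl = mk-cg (divides 0ℤ (+-inverseʳ x))

  cg-refl : ∀ j x → Cg j x x
  cg-refl j x = cg-≡ {j} refl

  cg-sym : ∀ {j x y} → Cg j x y → Cg j y x
  cg-sym {j} {x} {y} (mk-cg h) = mk-cg (subst (P^ j ∣_) (flip x y) (ZD.∣m⇒∣-m h))
    where flip : ∀ x y → - (x - y) ≡ y - x
          flip = solve-∀

  cg-trans : ∀ {j x y z} → Cg j x y → Cg j y z → Cg j x z
  cg-trans {j} {x} {y} {z} (mk-cg h) (mk-cg h') = mk-cg (subst (P^ j ∣_) (telescope x y z) (ZD.∣m∣n⇒∣m+n h h'))
    where telescope : ∀ x y z → (x - y) + (y - z) ≡ x - z
          telescope = solve-∀

  cg-+ : ∀ {j x y x' y'} → Cg j x y → Cg j x' y' → Cg j (x + x') (y + y')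
  cg-+ {j} {x} {y} {x'} {y'} (mk-cg h) (mk-cg h') = mk-cg (subst (P^ j ∣_) (regroup x y x' y') (ZD.∣m∣n⇒∣m+n h h'))
    where regroup : ∀ x y x' y' → (x - y) + (x' - y') ≡ (x + x') - (y + y')
          regroup = solve-∀

  cg-*l : ∀ {j x y} c → Cg j x y → Cg j (c * x) (c * y)
  cg-*l {j} {x} {y} c (mk-cg h) = mk-cg (subst (P^ j ∣_) (distrib c x y) (ZD.∣n⇒∣m*n c h))
    where distrib : ∀ c x y → c * (x - y) ≡ c * x - c * y
          distrib = solve-∀

  cg-*r : ∀ {j x y} c → Cg j x y → Cg j (x * c) (y * c)
  cg-*r {j} {x} {y} c h = subst₂ (Cg j) (*-comm c x) (*-comm c y) (cg-*l c h)

  cg-* : ∀ {j x y x' y'} → Cg j x y → Cg j x' y' → Cg j (x * x') (y * y')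
  cg-* {y = y} {x' = x'} h h' = cg-trans (cg-*r x' h) (cg-*l y h')

  cg-weak : ∀ {j x y} k → Cg (k N.+ j) x y → Cg j x y
  cg-weak {j} k (mk-cg h) = mk-cg (ZD.∣-trans (divides (P^ k) (P^-+ k j)) h)

  cg-weak≤ : ∀ {j k x y} → j ≤ k → Cg k x y → Cg j x y
  cg-weak≤ {j} {k} j≤k h = cg-weak (k N.∸ j) (subst (λ z → Cg z _ _) (sym (NP.m∸n+n≡m j≤k)) h)

  cg-0 : ∀ x y → Cg 0 x y
  cg-0 x y = mk-cg (divides (x - y) (sym (*-identityʳ (x - y))))

  cg-scale : ∀ {j x y} b → Cg j x y → Cg (b N.+ j) (P^ b * x) (P^ b * y)
  cg-scale {j} {x} {y} b (mk-cg h) = mk-cg (subst₂ _∣_ (sym (P^-+ b j)) (distrib (P^ b) x y) (ZD.*-monoʳ-∣ (P^ b) h))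
    where distrib : ∀ c x y → c * (x - y) ≡ c * x - c * y
          distrib = solve-∀

  cg-unscale : ∀ {j x y} b → Cg (b N.+ j) (P^ b * x) (P^ b * y) → Cg j x y
  cg-unscale {j} {x} {y} b (mk-cg h) = mk-cg (ZD.*-cancelˡ-∣ (P^ b) {{P^-nonZero {b}}} (subst₂ _∣_ (P^-+ b j) (distrib (P^ b) x y) h))
    where distrib : ∀ c x y → c * x - c * y ≡ c * (x - y)
          distrib = solve-∀

  cg-scaleB : ∀ {j x y} b B s → B ≡ s * P^ b → Cg j x y → Cg (b N.+ j) (B * x) (B * y)
  cg-scaleB {j} {x} {y} b B s B≡ h = subst₂ (Cg (b N.+ j)) (reassoc x) (reassoc y) (cg-*l s (cg-scale b h))
    where reassoc : ∀ z → s * (P^ b * z) ≡ B * z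
          reassoc z = trans (sym (*-assoc s (P^ b) z)) (cong (_* z) (sym B≡))

  cg-dvd : ∀ {j} x s → x ≡ s * P^ j → Cg j x 0ℤ
  cg-dvd x s x≡ = mk-cg (divides s (trans (+-identityʳ x) x≡))

  cg0⇒dvd : ∀ {j x} → Cg j x 0ℤ → P^ j ∣ x
  cg0⇒dvd {x = x} (mk-cg h) = subst (_ ∣_) (+-identityʳ x) h

  cg0⇒dvdℕ : ∀ {j a} → Cg j (+ a) 0ℤ → (p N.^ j) ND.∣ a
  cg0⇒dvdℕ h = ZD.∣⇒∣ᵤ (cg0⇒dvd h)

  cg-dvdℕ : ∀ {j} a → (p N.^ j) ND.∣ a → Cg j (+ a) 0ℤ
  cg-dvdℕ a (ND.divides s a≡) = cg-dvd (+ a) (+ s) (trans (cong +_ a≡) (pos-* s _))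

  cg-mul0 : ∀ {i i' x y} → Cg i x 0ℤ → Cg i' y 0ℤ → Cg (i N.+ i') (x * y) 0ℤ
  cg-mul0 {i} {i'} {x} {y} h h' = mk-cg (subst₂ _∣_ (sym (P^-+ i i')) (sym (+-identityʳ (x * y)))
      (ZD.∣-trans (ZD.*-monoˡ-∣ (P^ i') (cg0⇒dvd h)) (ZD.*-monoʳ-∣ x (cg0⇒dvd h'))))

  cg0-*r : ∀ {i x} y → Cg i x 0ℤ → Cg i (x * y) 0ℤ
  cg0-*r y h = cg-trans (cg-*r y h) (cg-≡ (*-zeroˡ y))

  Σ-cg : ∀ {j} n f g → (∀ b → b < n → Cg j (f b) (g b)) → Cg j (Σ< n f) (Σ< n g)
  Σ-cg {j} zero    f g h = cg-refl j 0ℤ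
  Σ-cg     (suc n) f g h = cg-+ (Σ-cg n f g (λ b lt → h b (NP.m<n⇒m<1+n lt))) (h n NP.≤-refl)

  cg-+p* : ∀ x t → Cg 1 (+ (x N.+ p N.* t)) (+ x)
  cg-+p* x t = mk-cg (divides (+ t) (begin
      + (x N.+ p N.* t) - + x     ≡⟨ cong (_- + x) (pos-+ x (p N.* t)) ⟩
      + x + + (p N.* t) - + x     ≡⟨ cancel (+ x) (+ (p N.* t)) ⟩
      + (p N.* t)                 ≡⟨ cong +_ (trans (NP.*-comm p t) (cong (t N.*_) (sym (NP.*-identityʳ p)))) ⟩
      + (t N.* (p N.* 1))         ≡⟨ pos-* t (p N.* 1) ⟩
      + t * P^ 1 ∎))
    where open ≡-Reasoning
          cancel : ∀ a b → a + b - a ≡ b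
          cancel = solve-∀

  p^∣-cancel : ∀ j u z → ¬ p ND.∣ u → (p N.^ j) ND.∣ (u N.* z) → (p N.^ j) ND.∣ z
  p^∣-cancel zero    u z _   _ = ND.1∣ z
  p^∣-cancel (suc j) u z p∤u d with euclidsLemma u z pr (ND.∣-trans (ND.∣m⇒∣m*n (p N.^ j) ND.∣-refl) d)
  ... | inj₁ p∣u = ⊥-elim (p∤u p∣u)
  ... | inj₂ (ND.divides z' refl) =
    subst (ND._∣ (z' N.* p)) (NP.*-comm (p N.^ j) p) (ND.*-monoˡ-∣ p (p^∣-cancel j u z' p∤u p^j∣uz'))
    where
      p^j∣uz' : (p N.^ j) ND.∣ (u N.* z')
      p^j∣uz' = ND.*-cancelʳ-∣ p (subst₂ ND._∣_ (NP.*-comm p (p N.^ j)) (sym (NP.*-assoc u z' p)) d)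

  Unit : ℤ → Set
  Unit u = ¬ p ND.∣ ∣ u ∣

  unit-* : ∀ u v → Unit u → Unit v → Unit (u * v)
  unit-* u v p∤u p∤v = subst (λ z → ¬ p ND.∣ z) (sym (∣i*j∣≡∣i∣*∣j∣ u v)) (p∤-* ∣ u ∣ ∣ v ∣ p∤u p∤v)

  unit-^ : ∀ u n → Unit u → Unit (u ^ n)
  unit-^ u zero    _   = p∤1
  unit-^ u (suc n) p∤u = unit-* u (u ^ n) p∤u (unit-^ u n p∤u)

  cg-cancel : ∀ {j x y} u → Unit u → Cg j (u * x) (u * y) → Cg j x y
  cg-cancel {j} {x} {y} u p∤u (mk-cg h) =
    mk-cg (ZD.∣ᵤ⇒∣ (p^∣-cancel j ∣ u ∣ ∣ x - y ∣ p∤u (subst ((p N.^ j) ND.∣_) (∣i*j∣≡∣i∣*∣j∣ u (x - y)) (ZD.∣⇒∣ᵤ h'))))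
    where h' : P^ j ∣ u * (x - y)
          h' = subst (P^ j ∣_) (distrib u x y) h
            where distrib : ∀ c x y → c * x - c * y ≡ c * (x - y)
                  distrib = solve-∀

  cg⇒%≡-ordered : ∀ {x y} → x ≤ y → Cg 1 (+ x) (+ y) → x % p ≡ y % p
  cg⇒%≡-ordered {x} {y} x≤y (mk-cg h) = sym (trans (cong (_% p) (sym (NP.m+[n∸m]≡n x≤y))) (%-remove-+ʳ x p∣y∸x))
    where
      p∣y∸x : p ND.∣ (y N.∸ x)
      p∣y∸x = subst₂ ND._∣_ (NP.*-identityʳ p) (trans (cong ∣_∣ (m-n≡m⊖n x y)) (∣⊖∣-≤ x≤y)) (ZD.∣⇒∣ᵤ h)

  cg⇒%≡ : ∀ x y → Cg 1 (+ x) (+ y) → x % p ≡ y % p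
  cg⇒%≡ x y h with NP.≤-total x y
  ... | inj₁ x≤y = cg⇒%≡-ordered x≤y h
  ... | inj₂ y≤x = sym (cg⇒%≡-ordered y≤x (cg-sym h))

module FactorialUnit (q : ℕ) (pr : Prime (suc (suc q))) where

  open import Data.Nat as N using (ℕ; zero; suc; _≤_; _<_; z≤n; s≤s; _!)
  import Data.Nat.Properties as NP
  open import Data.Nat.DivMod using (m%n<n)
  open import Data.Nat.Induction using (<-rec)
  import Data.Nat.Divisibility as ND
  open import Data.Integer hiding (suc; _≤_; _<_)
  open import Data.Integer.Properties
  open import Data.Integer.Tactic.RingSolver using (solve-∀)
  import Data.Nat.Tactic.RingSolver as NS
  open import Relation.Nullary using (¬_)
  open import Relation.Binary.PropositionalEquality
  open Congruence q pr public

  ν! ε! : ℕ → ℕ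
  ν! n = νp (n !)
  ε! n = εp (n !)

  ν!-zero : ν! 0 ≡ 0
  ν!-zero = ν-unit 1 p∤1

  ε!-zero : ε! 0 ≡ 1
  ε!-zero = ε-unit 1 p∤1

  ν!-suc : ∀ n → ν! (suc n) ≡ νp (suc n) N.+ ν! n
  ν!-suc n = ν-* (suc n) (n !) {{_}} {{n NP.!≢0}}

  ε!-suc : ∀ n → ε! (suc n) ≡ εp (suc n) N.* ε! n
  ε!-suc n = ε-* (suc n) (n !) {{_}} {{n NP.!≢0}}

  p∤ε! : ∀ n → ¬ p ND.∣ ε! n
  p∤ε! n = p∤ε (n !) {{n NP.!≢0}}

  legendre : ∀ n → suc q N.* ν! n N.+ σp n ≡ n
  legendre zero rewrite ν!-zero = trans (NP.+-identityʳ (suc q N.* 0)) (NP.*-zeroʳ (suc q))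
  legendre (suc n) = begin
      suc q N.* ν! (suc n) N.+ σp (suc n)
        ≡⟨ cong (λ z → suc q N.* z N.+ σp (suc n)) (ν!-suc n) ⟩
      suc q N.* (νp (suc n) N.+ ν! n) N.+ σp (suc n)
        ≡⟨ regroup (suc q) (νp (suc n)) (ν! n) (σp (suc n)) ⟩
      (σp (suc n) N.+ suc q N.* νp (suc n)) N.+ suc q N.* ν! n
        ≡⟨ cong (N._+ suc q N.* ν! n) (σ-ν-successor n) ⟩
      σp n N.+ 1 N.+ suc q N.* ν! n
        ≡⟨ regroup′ (σp n) (suc q N.* ν! n) ⟩
      suc (suc q N.* ν! n N.+ σp n)
        ≡⟨ cong suc (legendre n) ⟩
      suc n ∎
    where
      open ≡-Reasoning
      regroup : ∀ a b c d → a N.* (b N.+ c) N.+ d ≡ (d N.+ a N.* b) N.+ a N.* c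
      regroup = NS.solve-∀
      regroup′ : ∀ a b → a N.+ 1 N.+ b ≡ suc (b N.+ a)
      regroup′ = NS.solve-∀

  -- ν_p((pn)!) = n + ν_p(n!), from Legendre's formula and σ_p(pn) = σ_p(n).
  ν!-p* : ∀ n → ν! (p N.* n) ≡ n N.+ ν! n
  ν!-p* n = NP.*-cancelˡ-≡ (ν! (p N.* n)) (n N.+ ν! n) (suc q) (NP.+-cancelʳ-≡ (σp n) _ _ (begin
      suc q N.* ν! (p N.* n) N.+ σp n            ≡⟨ cong (suc q N.* ν! (p N.* n) N.+_) (sym (σ-p* n)) ⟩
      suc q N.* ν! (p N.* n) N.+ σp (p N.* n)    ≡⟨ legendre (p N.* n) ⟩
      p N.* n                                    ≡⟨ NP.+-comm n (suc q N.* n) ⟩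
      suc q N.* n N.+ n                          ≡⟨ cong (suc q N.* n N.+_) (sym (legendre n)) ⟩
      suc q N.* n N.+ (suc q N.* ν! n N.+ σp n)  ≡⟨ regroup n (suc q) (ν! n) (σp n) ⟩
      suc q N.* (n N.+ ν! n) N.+ σp n ∎))
    where
      open ≡-Reasoning
      regroup : ∀ n a b c → a N.* n N.+ (a N.* b N.+ c) ≡ a N.* (n N.+ b) N.+ c
      regroup = NS.solve-∀

  -- ε_p((pn + j)!) ≡ ε_p((pn)!)·ε_p(j!) (mod p) for j < p: the factors pn + i with 0 < i ≤ j
  -- are units congruent to i.
  ε!-digit : ∀ n j → j < p → Cg 1 (+ ε! (p N.* n N.+ j)) (+ ε! (p N.* n) * + ε! j)
  ε!-digit n zero _ rewrite NP.+-identityʳ (p N.* n) | ε!-zero = cg-≡ (sym (*-identityʳ _))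
  ε!-digit n (suc j) j+1<p =
    subst (λ z → Cg 1 (+ ε! z) (+ ε! (p N.* n) * + ε! (suc j))) (sym (NP.+-suc (p N.* n) j)) step
    where
      m : ℕ
      m = p N.* n N.+ j
      unit-factor : ∀ k → ¬ p ND.∣ suc k → + ε! (suc k) ≡ + suc k * + ε! k
      unit-factor k p∤ = trans (cong +_ (trans (ε!-suc k) (cong (N._* ε! k) (ε-unit (suc k) p∤)))) (pos-* (suc k) (ε! k))
      p∤m+1 : ¬ p ND.∣ suc m
      p∤m+1 = subst (λ z → ¬ p ND.∣ z) (cong suc (NP.+-comm j (p N.* n))) (p∤digit (suc j) n (s≤s z≤n) j+1<p)
      p∤j+1 : ¬ p ND.∣ suc j
      p∤j+1 = subst (λ z → ¬ p ND.∣ z) (trans (cong (suc j N.+_) (NP.*-zeroʳ p)) (NP.+-identityʳ (suc j)))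
                    (p∤digit (suc j) 0 (s≤s z≤n) j+1<p)
      m+1≡j+1 : Cg 1 (+ suc m) (+ suc j)
      m+1≡j+1 = subst (λ z → Cg 1 (+ suc z) (+ suc j)) (NP.+-comm j (p N.* n)) (cg-+p* (suc j) n)
      step : Cg 1 (+ ε! (suc m)) (+ ε! (p N.* n) * + ε! (suc j))
      step = cg-trans (cg-≡ (unit-factor m p∤m+1))
               (cg-trans (cg-* m+1≡j+1 (ε!-digit n j (NP.<-trans (NP.n<1+n j) j+1<p)))
                 (cg-≡ (trans (swap (+ suc j) (+ ε! (p N.* n)) (+ ε! j)) (cong (+ ε! (p N.* n) *_) (sym (unit-factor j p∤j+1))))))
        where swap : ∀ a b c → a * (b * c) ≡ b * (a * c)
              swap = solve-∀

  c! : ℤ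
  c! = + ε! (suc q)

  -- ε_p((pn)!) ≡ ε_p(n!)·c!^n (mod p): each block of p consecutive factors contributes c!,
  -- and the multiples p·i contribute ε_p(i).
  ε!-p* : ∀ n → Cg 1 (+ ε! (p N.* n)) (+ ε! n * c! ^ n)
  ε!-p* zero rewrite NP.*-zeroʳ p | ε!-zero = cg-refl 1 _
  ε!-p* (suc n) = subst (λ z → Cg 1 (+ ε! z) (+ ε! (suc n) * c! ^ suc n)) (sym p[n+1]≡) unfold-last
    where
      m : ℕ
      m = p N.* n N.+ suc q
      p[n+1]≡ : p N.* suc n ≡ suc m
      p[n+1]≡ = expand q n
        where expand : ∀ q n → suc (suc q) N.* suc n ≡ suc (suc (suc q) N.* n N.+ suc q)
              expand = NS.solve-∀
      last-factor : εp (suc m) ≡ εp (suc n)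
      last-factor = trans (cong εp (sym p[n+1]≡)) (ε-p* (suc n))
      -- (pn + p)! = (pn + p)·(pn + p - 1)!, and ε_p(pn + p) = ε_p(n + 1)
      unfold-last : Cg 1 (+ ε! (suc m)) (+ ε! (suc n) * c! ^ suc n)
      unfold-last =
        cg-trans (cg-≡ (trans (cong +_ (trans (ε!-suc m) (cong (N._* ε! m) last-factor))) (pos-* (εp (suc n)) (ε! m))))
          (cg-trans (cg-*l (+ εp (suc n)) (ε!-digit n (suc q) NP.≤-refl))
            (cg-trans (cg-*l (+ εp (suc n)) (cg-*r c! (ε!-p* n)))
              (cg-≡ (trans (regroup (+ εp (suc n)) (+ ε! n) (c! ^ n) c!)
                           (cong (_* (c! * c! ^ n)) (sym (trans (cong +_ (ε!-suc n)) (pos-* (εp (suc n)) (ε! n)))))))))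
        where regroup : ∀ a b c d → a * (b * c * d) ≡ a * b * (d * c)
              regroup = solve-∀

  -- For a power a of p (equivalently σ_p(a) = 1): ε_p(a!) ≡ c!^ν_p(a!) (mod p).
  ε!-power : ∀ a → σp a ≡ 1 → Cg 1 (+ ε! a) (c! ^ ν! a)
  ε!-power = <-rec _ λ a ih → by-last-digit a ih (a N.% p) (a N./ p) (m%n<n a p) (digits a)
    where
      Claim : ℕ → Set
      Claim a = σp a ≡ 1 → Cg 1 (+ ε! a) (c! ^ ν! a)

      by-last-digit : ∀ a → (∀ {b} → b < a → Claim b) → ∀ r t → r < p → a ≡ r N.+ p N.* t → Claim a
      by-last-digit a ih zero t r<p refl σa≡1 = cg-trans (ε!-p* t) (cg-trans (cg-*r (c! ^ t) (ih t<pt σt≡1)) (cg-≡ exponent))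
        where
          σt≡1 : σp t ≡ 1
          σt≡1 = trans (sym (σ-digit 0 t r<p)) σa≡1
          t≢0 : t ≢ 0
          t≢0 refl with () ← σt≡1
          t<pt : t < p N.* t
          t<pt = subst (t <_) (NP.*-comm t p) (NP.m<m*n t p {{N.≢-nonZero t≢0}} (s≤s (s≤s z≤n)))
          exponent : c! ^ ν! t * c! ^ t ≡ c! ^ ν! (p N.* t)
          exponent = trans (sym (^-distribˡ-+-* c! (ν! t) t)) (cong (c! ^_) (trans (NP.+-comm (ν! t) t) (sym (ν!-p* t))))
      by-last-digit a ih (suc zero) t r<p refl σa≡1 =
        subst (λ x → Cg 1 (+ ε! x) (c! ^ ν! x)) (sym a≡1) (cg-≡ (trans (cong +_ (ε-unit 1 p∤1)) (cong (c! ^_) (sym (ν-unit 1 p∤1)))))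
        where
          a≡1 : 1 N.+ p N.* t ≡ 1
          a≡1 = cong suc (trans (cong (p N.*_) (σ≡0⇒≡0 t (NP.suc-injective (trans (sym (σ-digit 1 t r<p)) σa≡1)))) (NP.*-zeroʳ p))
      by-last-digit a ih (suc (suc r)) t r<p refl σa≡1 with () ← trans (sym σa≡1) (σ-digit (suc (suc r)) t r<p)

-- The leading term of F(n,k) = k!·S(n,k): modulo p^(L+1), where (p-1)L = k - σ_p(n),
-- only the ordered partitions into blocks whose sizes are powers of p contribute.
module LeadingTerm (q : ℕ) (pr : Prime (suc (suc q))) where

  open import Data.Nat as N using (ℕ; zero; suc; _≤_; _<_; z≤n; s≤s; _!; _∸_)
  import Data.Nat.Properties as NP
  open import Data.Nat.Combinatorics using (_C_)
  open import Data.Integer hiding (suc; _≤_; _<_)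
  open import Data.Integer.Properties
  open import Data.Integer.Tactic.RingSolver using (solve-∀)
  import Data.Nat.Tactic.RingSolver as NS
  open import Data.Product using (_×_; _,_; proj₁; proj₂)
  open import Data.Sum using (_⊎_; inj₁; inj₂; [_,_]′)
  open import Data.Empty using (⊥-elim)
  open import Relation.Nullary using (Dec; yes; no)
  open import Relation.Binary.PropositionalEquality
  open FiniteSum
  open Binomial
  open Stirling
  open FactorialUnit q pr public

  -- δpow a = 1 if a is a power of p (equivalently σ_p(a) = 1), and 0 otherwise.
  δpow : ℕ → ℤ
  δpow a = 𝟙 (σp a N.≟ 1)

  δpow-yes : ∀ a → σp a ≡ 1 → δpow a ≡ 1ℤ
  δpow-yes a = 𝟙-yes (σp a N.≟ 1)

  δpow-no : ∀ a → σp a ≢ 1 → δpow a ≡ 0ℤ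
  δpow-no a = 𝟙-no (σp a N.≟ 1)

  -- Comp n k: the number of compositions of n into k parts that are powers of p,
  -- counted by the size n - b of the first part.
  Comp : ℕ → ℕ → ℤ
  Comp n       (suc k) = Σ< n (λ b → δpow (n ∸ b) * Comp b k)
  Comp zero    zero    = 1ℤ
  Comp (suc n) zero    = 0ℤ

  Comp-vanishes : ∀ k b → b < k → Comp b k ≡ 0ℤ
  Comp-vanishes (suc k) b (s≤s b≤k) =
    Σ-zero b _ (λ i i<b → trans (cong (δpow (b ∸ i) *_) (Comp-vanishes k i (NP.<-≤-trans i<b b≤k))) (*-zeroʳ (δpow (b ∸ i))))

  module BinomialValuation (a b : ℕ) where
    n binom : ℕ
    n = a N.+ b
    binom = n C b

    binom-factorial : binom N.* (b ! N.* a !) ≡ n !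
    binom-factorial = subst (λ z → binom N.* (b ! N.* z !) ≡ n !) (NP.m+n∸n≡m a b) (binomial-factorial n b (NP.m≤n+m b a))

    instance
      binom-nonZero : N.NonZero binom
      binom-nonZero = N.≢-nonZero (λ binom≡0 → N.≢-nonZero⁻¹ (n !) {{n NP.!≢0}}
                                    (trans (sym binom-factorial) (cong (N._* (b ! N.* a !)) binom≡0)))
      factorials-nonZero : N.NonZero (b ! N.* a !)
      factorials-nonZero = NP.m*n≢0 (b !) (a !) {{b NP.!≢0}} {{a NP.!≢0}}

    β : ℕ
    β = νp binom

    ν!-split : ν! n ≡ β N.+ (ν! b N.+ ν! a)
    ν!-split = trans (cong νp (sym binom-factorial)) (trans (ν-* binom (b ! N.* a !)) (cong (β N.+_) (ν-* (b !) (a !) {{b NP.!≢0}} {{a NP.!≢0}})))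

    ε!-split : ε! n ≡ εp binom N.* (ε! b N.* ε! a)
    ε!-split = trans (cong εp (sym binom-factorial)) (trans (ε-* binom (b ! N.* a !)) (cong (εp binom N.*_) (ε-* (b !) (a !) {{b NP.!≢0}} {{a NP.!≢0}})))

    -- Kummer's theorem: ν_p C(a+b,b) counts the carries, (p-1)·β = σ(a) + σ(b) - σ(a+b).
    kummer : suc q N.* β N.+ σp n ≡ σp a N.+ σp b
    kummer = NP.+-cancelʳ-≡ (suc q N.* ν! b N.+ suc q N.* ν! a) _ _ (begin
        suc q N.* β N.+ σp n N.+ (suc q N.* ν! b N.+ suc q N.* ν! a)
          ≡⟨ regroup (suc q) β (σp n) (ν! b) (ν! a) ⟩
        suc q N.* (β N.+ (ν! b N.+ ν! a)) N.+ σp n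
          ≡⟨ cong (λ z → suc q N.* z N.+ σp n) (sym ν!-split) ⟩
        suc q N.* ν! n N.+ σp n
          ≡⟨ legendre n ⟩
        a N.+ b
          ≡⟨ cong₂ N._+_ (sym (legendre a)) (sym (legendre b)) ⟩
        (suc q N.* ν! a N.+ σp a) N.+ (suc q N.* ν! b N.+ σp b)
          ≡⟨ regroup′ (suc q) (ν! a) (σp a) (ν! b) (σp b) ⟩
        σp a N.+ σp b N.+ (suc q N.* ν! b N.+ suc q N.* ν! a) ∎)
      where
        open ≡-Reasoning
        regroup : ∀ c x y u v → c N.* x N.+ y N.+ (c N.* u N.+ c N.* v) ≡ c N.* (x N.+ (u N.+ v)) N.+ y
        regroup = NS.solve-∀
        regroup′ : ∀ c x y u v → c N.* x N.+ y N.+ (c N.* u N.+ v) ≡ y N.+ v N.+ (c N.* u N.+ c N.* x)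
        regroup′ = NS.solve-∀

    binom-factor : + binom ≡ + εp binom * P^ β
    binom-factor = trans (cong +_ (trans (proj₁ (factorisation binom)) (NP.*-comm (p N.^ β) (εp binom)))) (pos-* (εp binom) (p N.^ β))

    binom-divisible : Cg β (+ binom) 0ℤ
    binom-divisible = cg-dvd (+ binom) (+ εp binom) binom-factor

    unit-relation : + binom * (+ ε! a * + ε! b) ≡ P^ β * + ε! n
    unit-relation = begin
        + binom * (+ ε! a * + ε! b)                 ≡⟨ cong (_* (+ ε! a * + ε! b)) binom-factor ⟩
        + εp binom * P^ β * (+ ε! a * + ε! b)       ≡⟨ regroup (+ εp binom) (P^ β) (+ ε! a) (+ ε! b) ⟩
        P^ β * (+ εp binom * (+ ε! b * + ε! a))     ≡⟨ cong (P^ β *_) (sym (trans (cong +_ ε!-split) (trans (pos-* (εp binom) _) (cong (+ εp binom *_) (pos-* (ε! b) (ε! a)))))) ⟩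
        P^ β * + ε! n ∎
      where
        open ≡-Reasoning
        regroup : ∀ x y z t → x * y * (z * t) ≡ y * (x * (t * z))
        regroup = solve-∀

  -- Digit sums are subadditive, a consequence of Kummer's theorem.
  σ-subadditive : ∀ n b → b ≤ n → σp n ≤ σp (n ∸ b) N.+ σp b
  σ-subadditive n b b≤n = subst (λ z → σp z ≤ σp (n ∸ b) N.+ σp b) (NP.m∸n+n≡m b≤n)
    (subst (σp ((n ∸ b) N.+ b) ≤_) (BinomialValuation.kummer (n ∸ b) b) (NP.m≤n+m _ (suc q N.* BinomialValuation.β (n ∸ b) b)))

  Comp-below-σ : ∀ k n → k < σp n → Comp n k ≡ 0ℤ
  Comp-below-σ zero    zero    ()
  Comp-below-σ zero    (suc n) _ = refl
  Comp-below-σ (suc k) n k<σn = Σ-zero n _ term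
    where
      term : ∀ b → b < n → δpow (n ∸ b) * Comp b k ≡ 0ℤ
      term b b<n = by-σ (σp (n ∸ b) N.≟ 1)
       where
        by-σ : Dec (σp (n ∸ b) ≡ 1) → δpow (n ∸ b) * Comp b k ≡ 0ℤ
        by-σ (no σ≢1) = cong (_* Comp b k) (δpow-no (n ∸ b) σ≢1)
        by-σ (yes σ≡1) = trans (cong (δpow (n ∸ b) *_) (Comp-below-σ k b k<σb)) (*-zeroʳ (δpow (n ∸ b)))
          where
            σn≤1+σb : σp n ≤ 1 N.+ σp b
            σn≤1+σb = subst (λ z → σp n ≤ z N.+ σp b) σ≡1 (σ-subadditive n b (NP.<⇒≤ b<n))
            k<σb : k < σp b
            k<σb = NP.≤-pred (NP.≤-trans k<σn σn≤1+σb)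

  carry-budget : ∀ {x y s t u c K} → x N.+ s ≡ t N.+ u → c ≤ t → y N.+ x N.+ s ≤ K → y N.+ u N.+ c ≤ K
  carry-budget {x} {y} {s} {t} {u} {c} {K} e c≤t le = NP.≤-trans (NP.+-monoʳ-≤ (y N.+ u) c≤t) (subst (_≤ K) shuffle le)
    where
      regroup : ∀ y x s → y N.+ x N.+ s ≡ y N.+ (x N.+ s)
      regroup = NS.solve-∀
      regroup′ : ∀ y t u → y N.+ (t N.+ u) ≡ y N.+ u N.+ t
      regroup′ = NS.solve-∀
      shuffle : y N.+ x N.+ s ≡ y N.+ u N.+ t
      shuffle = trans (regroup y x s) (trans (cong (y N.+_) e) (regroup′ y t u))

  F-divisible : ∀ k n j → suc q N.* j N.+ σp n < k N.+ suc q → Cg j (+ F n k) 0ℤ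
  F-divisible zero n zero _ = cg-0 _ _
  F-divisible zero n (suc j) lt = ⊥-elim (NP.<-irrefl refl (NP.≤-trans lt (NP.≤-trans (NP.m≤m*n (suc q) (suc j)) (NP.m≤m+n _ (σp n)))))
  F-divisible (suc k) n j lt =
    subst (λ z → Cg j z 0ℤ) (sym (F-binomial n k)) (cg-trans (Σ-cg n _ (λ _ → 0ℤ) term) (cg-≡ (Σ-zero n (λ _ → 0ℤ) (λ _ _ → refl))))
    where
      -- the term of C(a+b,b)·F(b,k), a = n - b ≥ 1: either C(a+b,b) is divisible by p^j,
      -- or the carries β = ν_p C(a+b,b) leave enough room to use the bound for F(b,k)
      term : ∀ b → b < n → Cg j (+ (n C b) * + F b k) 0ℤ
      term b b<n = subst (λ z → Cg j (+ (z C b) * + F b k) 0ℤ) (NP.m∸n+n≡m (NP.<⇒≤ b<n)) (by-β (j N.≤? β))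
        where
          a : ℕ
          a = n ∸ b
          open BinomialValuation a b using (binom; β; binom-divisible; kummer)
          by-β : Dec (j ≤ β) → Cg j (+ binom * + F b k) 0ℤ
          by-β (yes j≤β) = cg0-*r (+ F b k) (cg-weak≤ j≤β binom-divisible)
          by-β (no j≰β) = subst (λ z → Cg z (+ binom * + F b k) 0ℤ) β+j′≡j (cg-mul0 binom-divisible (F-divisible k b j′ room))
            where
              j′ : ℕ
              j′ = j ∸ β
              β+j′≡j : β N.+ j′ ≡ j
              β+j′≡j = NP.m+[n∸m]≡n (NP.<⇒≤ (NP.≰⇒> j≰β))
              kummer′ : suc q N.* β N.+ σp n ≡ σp a N.+ σp b
              kummer′ = subst (λ z → suc q N.* β N.+ σp z ≡ σp a N.+ σp b) (NP.m∸n+n≡m (NP.<⇒≤ b<n)) kummer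
              budget : suc q N.* j′ N.+ suc q N.* β N.+ σp n ≤ k N.+ suc q
              budget = subst (λ z → z N.+ σp n ≤ k N.+ suc q)
                         (trans (cong (suc q N.*_) (sym β+j′≡j)) (trans (NP.*-distribˡ-+ (suc q) β j′) (NP.+-comm (suc q N.* β) _)))
                         (NP.≤-pred lt)
              room : suc q N.* j′ N.+ σp b < k N.+ suc q
              room = subst (_≤ k N.+ suc q) (NP.+-comm _ 1)
                       (carry-budget kummer′ (σ-positive a (NP.n≢0⇒n>0 (NP.m>n⇒m∸n≢0 b<n))) budget)

  LeadingTermAt : ℕ → Set
  LeadingTermAt k = ∀ n L M → suc q N.* L N.+ σp n ≡ k → suc q N.* M N.+ k ≡ n →
                    Cg (suc L) (+ F n k * c! ^ M) (P^ L * + ε! n * Comp n k)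

  term-negligible : ∀ k a b L → suc q N.* L N.+ σp (a N.+ b) ≡ suc k →
                    2 ≤ σp a ⊎ suc L ≤ BinomialValuation.β a b →
                    Cg (suc L) (+ BinomialValuation.binom a b * + F b k) 0ℤ
  term-negligible k a b L h1 big = by-β (suc L N.≤? β)
    where
      open BinomialValuation a b using (binom; β; binom-divisible; kummer)
      by-β : Dec (suc L ≤ β) → Cg (suc L) (+ binom * + F b k) 0ℤ
      by-β (yes L<β) = cg0-*r (+ F b k) (cg-weak≤ L<β binom-divisible)
      by-β (no L≮β) = subst (λ z → Cg z (+ binom * + F b k) 0ℤ) β+j′≡ (cg-mul0 binom-divisible (F-divisible k b j′ room))
        where
          j′ : ℕ
          j′ = suc L ∸ β
          β+j′≡ : β N.+ j′ ≡ suc L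
          β+j′≡ = NP.m+[n∸m]≡n (NP.<⇒≤ (NP.≰⇒> L≮β))
          σa≥2 : 2 ≤ σp a
          σa≥2 = [ (λ σa≥2 → σa≥2) , (λ L<β → ⊥-elim (L≮β L<β)) ]′ big
          budget : suc q N.* j′ N.+ suc q N.* β N.+ σp (a N.+ b) ≡ suc (k N.+ suc q)
          budget = begin
            suc q N.* j′ N.+ suc q N.* β N.+ σp (a N.+ b)   ≡⟨ cong (N._+ σp (a N.+ b)) (trans (NP.+-comm (suc q N.* j′) _) (sym (NP.*-distribˡ-+ (suc q) β j′))) ⟩
            suc q N.* (β N.+ j′) N.+ σp (a N.+ b)           ≡⟨ cong (λ z → suc q N.* z N.+ σp (a N.+ b)) β+j′≡ ⟩
            suc q N.* suc L N.+ σp (a N.+ b)                ≡⟨ regroup (suc q) L (σp (a N.+ b)) ⟩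
            suc q N.* L N.+ σp (a N.+ b) N.+ suc q          ≡⟨ cong (N._+ suc q) h1 ⟩
            suc (k N.+ suc q) ∎
            where open ≡-Reasoning
                  regroup : ∀ c L s → c N.* suc L N.+ s ≡ c N.* L N.+ s N.+ c
                  regroup = NS.solve-∀
          room : suc q N.* j′ N.+ σp b < k N.+ suc q
          room = NP.≤-pred (subst (_≤ suc (k N.+ suc q)) (NP.+-comm _ 2) (carry-budget kummer σa≥2 (NP.≤-reflexive budget)))

  exponent-L-reduced : ∀ k a b L → σp a ≡ 1 → BinomialValuation.β a b ≤ L →
                       suc q N.* L N.+ σp (a N.+ b) ≡ suc k → suc q N.* (L ∸ BinomialValuation.β a b) N.+ σp b ≡ k
  exponent-L-reduced k a b L σa≡1 β≤L h1 = NP.suc-injective (begin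
      suc (suc q N.* Lb N.+ σp b)                          ≡⟨ regroup (suc q N.* Lb) (σp b) ⟩
      suc q N.* Lb N.+ (1 N.+ σp b)                        ≡⟨ cong (λ z → suc q N.* Lb N.+ (z N.+ σp b)) (sym σa≡1) ⟩
      suc q N.* Lb N.+ (σp a N.+ σp b)                     ≡⟨ cong (suc q N.* Lb N.+_) (sym kummer) ⟩
      suc q N.* Lb N.+ (suc q N.* β N.+ σp (a N.+ b))      ≡⟨ regroup′ (suc q) Lb β (σp (a N.+ b)) ⟩
      suc q N.* (β N.+ Lb) N.+ σp (a N.+ b)                ≡⟨ cong (λ z → suc q N.* z N.+ σp (a N.+ b)) (NP.m+[n∸m]≡n β≤L) ⟩
      suc q N.* L N.+ σp (a N.+ b)                         ≡⟨ h1 ⟩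
      suc k ∎)
    where
      open ≡-Reasoning
      open BinomialValuation a b using (β; kummer)
      Lb : ℕ
      Lb = L ∸ β
      regroup : ∀ x y → suc (x N.+ y) ≡ x N.+ (1 N.+ y)
      regroup = NS.solve-∀
      regroup′ : ∀ c x y z → c N.* x N.+ (c N.* y N.+ z) ≡ c N.* (y N.+ x) N.+ z
      regroup′ = NS.solve-∀

  exponent-M-reduced : ∀ k a b M → σp a ≡ 1 → k ≤ b → suc q N.* M N.+ suc k ≡ a N.+ b →
                       ν! a ≤ M × suc q N.* (M ∸ ν! a) N.+ k ≡ b
  exponent-M-reduced k a b M σa≡1 k≤b h2 = ν!a≤M , NP.+-cancelˡ-≡ (suc q N.* ν! a) _ _ (begin
      suc q N.* ν! a N.+ (suc q N.* (M ∸ ν! a) N.+ k)    ≡⟨ regroup (suc q) (ν! a) (M ∸ ν! a) k ⟩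
      suc q N.* (ν! a N.+ (M ∸ ν! a)) N.+ k              ≡⟨ cong (λ z → suc q N.* z N.+ k) (NP.m+[n∸m]≡n ν!a≤M) ⟩
      suc q N.* M N.+ k                                  ≡⟨ balance ⟩
      suc q N.* ν! a N.+ b ∎)
    where
      open ≡-Reasoning
      regroup : ∀ c x y z → c N.* x N.+ (c N.* y N.+ z) ≡ c N.* (x N.+ y) N.+ z
      regroup = NS.solve-∀
      a≡ : suc q N.* ν! a N.+ 1 ≡ a
      a≡ = trans (cong (suc q N.* ν! a N.+_) (sym σa≡1)) (legendre a)
      balance : suc q N.* M N.+ k ≡ suc q N.* ν! a N.+ b
      balance = NP.suc-injective (trans (sym (NP.+-suc (suc q N.* M) k)) (trans h2 (trans (cong (N._+ b) (sym a≡)) (shift (suc q N.* ν! a) b))))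
        where shift : ∀ x y → x N.+ 1 N.+ y ≡ suc (x N.+ y)
              shift = NS.solve-∀
      ν!a≤M : ν! a ≤ M
      ν!a≤M = NP.*-cancelˡ-≤ (suc q) (NP.+-cancelʳ-≤ b _ _ (subst (_≤ suc q N.* M N.+ b) balance (NP.+-monoʳ-≤ (suc q N.* M) k≤b)))

  binom-unit-power : ∀ a b → σp a ≡ 1 →
    Cg (BinomialValuation.β a b N.+ 1) (+ BinomialValuation.binom a b * c! ^ ν! a) (+ BinomialValuation.binom a b * + ε! a)
  binom-unit-power a b σa≡1 = cg-scaleB β (+ binom) (+ εp binom) binom-factor (cg-sym (ε!-power a σa≡1))
    where open BinomialValuation a b using (binom; β; binom-factor)

  term-units : ∀ a b Lb (x : ℤ) →
    P^ Lb * (+ BinomialValuation.binom a b * + ε! a) * (+ ε! b * x) ≡ P^ (BinomialValuation.β a b N.+ Lb) * + ε! (a N.+ b) * (1ℤ * x)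
  term-units a b Lb x = begin
      P^ Lb * (+ binom * + ε! a) * (+ ε! b * x)          ≡⟨ regroup (P^ Lb) (+ binom) (+ ε! a) (+ ε! b) x ⟩
      P^ Lb * (+ binom * (+ ε! a * + ε! b)) * (1ℤ * x)   ≡⟨ cong (λ z → P^ Lb * z * (1ℤ * x)) unit-relation ⟩
      P^ Lb * (P^ β * + ε! (a N.+ b)) * (1ℤ * x)         ≡⟨ cong (_* (1ℤ * x)) (regroup′ (P^ Lb) (P^ β) (+ ε! (a N.+ b))) ⟩
      P^ β * P^ Lb * + ε! (a N.+ b) * (1ℤ * x)           ≡⟨ cong (λ z → z * + ε! (a N.+ b) * (1ℤ * x)) (sym (P^-+ β Lb)) ⟩
      P^ (β N.+ Lb) * + ε! (a N.+ b) * (1ℤ * x) ∎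
    where
      open ≡-Reasoning
      open BinomialValuation a b using (binom; β; unit-relation)
      regroup : ∀ x y z t u → x * (y * z) * (t * u) ≡ x * (y * (z * t)) * (1ℤ * u)
      regroup = solve-∀
      regroup′ : ∀ x y z → x * (y * z) ≡ y * x * z
      regroup′ = solve-∀

  -- The surviving terms: a is a power of p, β ≤ L and k ≤ b.  Then the leading-term
  -- congruence for (b, k), multiplied by C(a+b,b)·c!^ν_p(a!), gives the one for the term.
  term-leading : ∀ k → LeadingTermAt k → ∀ a b L M → σp a ≡ 1 →
                 BinomialValuation.β a b ≤ L → k ≤ b →
                 suc q N.* L N.+ σp (a N.+ b) ≡ suc k → suc q N.* M N.+ suc k ≡ a N.+ b →
                 Cg (suc L) (+ BinomialValuation.binom a b * + F b k * c! ^ M)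
                            (P^ L * + ε! (a N.+ b) * (1ℤ * Comp b k))
  term-leading k ih a b L M σa≡1 β≤L k≤b h1 h2 =
    cg-trans (cg-≡ eqL)
      (cg-trans (subst (λ z → Cg z (B * (+ F b k * c! ^ Mb)) (B * Y)) (trans (NP.+-suc β Lb) (cong suc β+Lb≡L)) step1)
        (cg-trans (cg-≡ eqM)
          (cg-trans (subst (λ z → Cg z (P^ Lb * B * Z) (P^ Lb * (+ binom * + ε! a) * Z)) exponent step2)
            (cg-≡ (trans (term-units a b Lb (Comp b k)) (cong (λ z → P^ z * + ε! (a N.+ b) * (1ℤ * Comp b k)) β+Lb≡L))))))
    where
      open BinomialValuation a b using (binom; β; binom-factor)
      Lb Mb : ℕ
      Lb = L ∸ β
      Mb = M ∸ ν! a
      β+Lb≡L : β N.+ Lb ≡ L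
      β+Lb≡L = NP.m+[n∸m]≡n β≤L
      reducedM : ν! a ≤ M × suc q N.* Mb N.+ k ≡ b
      reducedM = exponent-M-reduced k a b M σa≡1 k≤b h2
      B Y Z : ℤ
      B = + binom * c! ^ ν! a
      Y = P^ Lb * + ε! b * Comp b k
      Z = + ε! b * Comp b k
      IH : Cg (suc Lb) (+ F b k * c! ^ Mb) Y
      IH = ih b Lb Mb (exponent-L-reduced k a b L σa≡1 β≤L h1) (proj₂ reducedM)
      B-divisible : B ≡ (+ εp binom * c! ^ ν! a) * P^ β
      B-divisible = trans (cong (_* c! ^ ν! a) binom-factor) (swap (+ εp binom) (P^ β) (c! ^ ν! a))
        where swap : ∀ x y z → x * y * z ≡ x * z * y
              swap = solve-∀
      step1 : Cg (β N.+ suc Lb) (B * (+ F b k * c! ^ Mb)) (B * Y)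
      step1 = cg-scaleB β B (+ εp binom * c! ^ ν! a) B-divisible IH
      step2 : Cg (Lb N.+ (β N.+ 1)) (P^ Lb * B * Z) (P^ Lb * (+ binom * + ε! a) * Z)
      step2 = cg-*r Z (cg-scale Lb (binom-unit-power a b σa≡1))
      exponent : Lb N.+ (β N.+ 1) ≡ suc L
      exponent = trans (cong (Lb N.+_) (NP.+-comm β 1)) (trans (NP.+-suc Lb β) (cong suc (trans (NP.+-comm Lb β) β+Lb≡L)))
      eqL : + binom * + F b k * c! ^ M ≡ B * (+ F b k * c! ^ Mb)
      eqL = trans (cong (λ z → + binom * + F b k * c! ^ z) (sym (NP.m+[n∸m]≡n (proj₁ reducedM))))
              (trans (cong (+ binom * + F b k *_) (^-distribˡ-+-* c! (ν! a) Mb)) (regroup (+ binom) (+ F b k) (c! ^ ν! a) (c! ^ Mb)))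
        where regroup : ∀ x y z t → x * y * (z * t) ≡ x * z * (y * t)
              regroup = solve-∀
      eqM : B * Y ≡ P^ Lb * B * Z
      eqM = regroup B (P^ Lb) (+ ε! b) (Comp b k)
        where regroup : ∀ x y z t → x * (y * z * t) ≡ y * x * (z * t)
              regroup = solve-∀

  term-congruence : ∀ k → LeadingTermAt k → ∀ a b L M → 1 ≤ a →
                    suc q N.* L N.+ σp (a N.+ b) ≡ suc k → suc q N.* M N.+ suc k ≡ a N.+ b →
                    Cg (suc L) (+ BinomialValuation.binom a b * + F b k * c! ^ M)
                               (P^ L * + ε! (a N.+ b) * (δpow a * Comp b k))
  term-congruence k ih a b L M 1≤a h1 h2 = by-σ (σp a N.≟ 1)
    where
      open BinomialValuation a b using (binom; β; kummer)
      LHS : ℤ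
      LHS = + binom * + F b k * c! ^ M
      RHS : ℤ → ℤ
      RHS z = P^ L * + ε! (a N.+ b) * (z * Comp b k)
      RHS-vanishes : ∀ z → Comp b k ≡ 0ℤ → RHS z ≡ 0ℤ
      RHS-vanishes z Comp≡0 = trans (cong (λ w → P^ L * + ε! (a N.+ b) * (z * w)) Comp≡0)
                                    (trans (cong (P^ L * + ε! (a N.+ b) *_) (*-zeroʳ z)) (*-zeroʳ (P^ L * + ε! (a N.+ b))))
      negligible : 2 ≤ σp a ⊎ suc L ≤ β → Cg (suc L) LHS 0ℤ
      negligible big = cg0-*r (c! ^ M) (term-negligible k a b L h1 big)

      by-σ : Dec (σp a ≡ 1) → Cg (suc L) LHS (RHS (δpow a))
      by-σ (no σa≢1) = cg-trans (negligible (inj₁ (NP.≤∧≢⇒< (σ-positive a 1≤a) (λ 1≡σa → σa≢1 (sym 1≡σa)))))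
                                (cg-≡ (sym (trans (cong (λ z → P^ L * + ε! (a N.+ b) * (z * Comp b k)) (δpow-no a σa≢1)) (*-zeroʳ (P^ L * + ε! (a N.+ b))))))
      by-σ (yes σa≡1) = subst (λ z → Cg (suc L) LHS (RHS z)) (sym (δpow-yes a σa≡1)) (by-β (suc L N.≤? β))
        where
          by-k : Dec (k ≤ b) → β ≤ L → Cg (suc L) LHS (RHS 1ℤ)
          by-k (yes k≤b) β≤L = term-leading k ih a b L M σa≡1 β≤L k≤b h1 h2
          by-k (no k≰b) _ = cg-≡ (trans (cong (λ z → + binom * + z * c! ^ M) (F-vanishes k b (NP.≰⇒> k≰b)))
                                   (trans (cong (_* c! ^ M) (*-zeroʳ (+ binom)))
                                     (trans (*-zeroˡ (c! ^ M)) (sym (RHS-vanishes 1ℤ (Comp-vanishes k b (NP.≰⇒> k≰b)))))))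
          -- with more than L carries, too few powers of p remain for b: k < σ_p(b)
          by-β : Dec (suc L ≤ β) → Cg (suc L) LHS (RHS 1ℤ)
          by-β (no L≮β) = by-k (k N.≤? b) (NP.≤-pred (NP.≰⇒> L≮β))
          by-β (yes L<β) = cg-trans (negligible (inj₂ L<β)) (cg-≡ (sym (RHS-vanishes 1ℤ (Comp-below-σ k b k<σb))))
            where
              carries : suc q N.* suc L N.+ σp (a N.+ b) ≤ 1 N.+ σp b
              carries = subst (λ z → suc q N.* suc L N.+ σp (a N.+ b) ≤ z N.+ σp b) σa≡1
                          (NP.≤-trans (NP.+-monoˡ-≤ (σp (a N.+ b)) (NP.*-monoʳ-≤ (suc q) L<β)) (NP.≤-reflexive kummer))
              expand : suc q N.* suc L N.+ σp (a N.+ b) ≡ suc (k N.+ suc q)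
              expand = trans (cong (N._+ σp (a N.+ b)) (NP.*-suc (suc q) L)) (trans (regroup (suc q) (suc q N.* L) (σp (a N.+ b))) (cong (N._+ suc q) h1))
                where regroup : ∀ x y z → x N.+ y N.+ z ≡ y N.+ z N.+ x
                      regroup = NS.solve-∀
              k<σb : k < σp b
              k<σb = NP.<-≤-trans (NP.m<m+n k (s≤s z≤n)) (NP.≤-pred (subst (_≤ 1 N.+ σp b) expand carries))

  leading-term : ∀ k → LeadingTermAt k
  leading-term zero n L M h1 h2 = base L≡0 n≡0 M≡0
    where
      base : ∀ {L n M} → L ≡ 0 → n ≡ 0 → M ≡ 0 → Cg (suc L) (+ F n 0 * c! ^ M) (P^ L * + ε! n * Comp n 0)
      base refl refl refl rewrite ε!-zero = cg-refl 1 _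
      cancel-p-1 : ∀ L → suc q N.* L ≡ 0 → L ≡ 0
      cancel-p-1 zero    _ = refl
      cancel-p-1 (suc L) ()
      L≡0 : L ≡ 0
      L≡0 = cancel-p-1 L (NP.m+n≡0⇒m≡0 _ h1)
      n≡0 : n ≡ 0
      n≡0 = σ≡0⇒≡0 n (NP.m+n≡0⇒n≡0 (suc q N.* L) h1)
      M≡0 : M ≡ 0
      M≡0 = cancel-p-1 M (NP.m+n≡0⇒m≡0 _ (trans h2 n≡0))
  leading-term (suc k) n L M h1 h2 =
    subst (λ z → Cg (suc L) (z * c! ^ M) (P^ L * + ε! n * Comp n (suc k))) (sym (F-binomial n k))
      (cg-trans (cg-≡ (Σ-*ʳ n _ (c! ^ M))) (cg-trans (Σ-cg n _ _ term) (cg-≡ (Σ-*ˡ n (P^ L * + ε! n) _))))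
    where
      term : ∀ b → b < n → Cg (suc L) (+ (n C b) * + F b k * c! ^ M) (P^ L * + ε! n * (δpow (n ∸ b) * Comp b k))
      term b b<n = subst (λ z → Cg (suc L) (+ (z C b) * + F b k * c! ^ M) (P^ L * + ε! z * (δpow (n ∸ b) * Comp b k))) a+b≡n
                     (term-congruence k (leading-term k) (n ∸ b) b L M (NP.n≢0⇒n>0 (NP.m>n⇒m∸n≢0 b<n))
                        (subst (λ z → suc q N.* L N.+ σp z ≡ suc k) (sym a+b≡n) h1) (trans h2 (sym a+b≡n)))
        where a+b≡n : n ∸ b N.+ b ≡ n
              a+b≡n = NP.m∸n+n≡m (NP.<⇒≤ b<n)

-- Classifying compositions into powers of p by their parts equal to 1.  A power of p is
-- either 1 or p times a power of p; counting the parts equal to 1 gives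
--   Comp(n,k) = Σ_i C(k,i)·CompMixed(n,i,k-i),
-- where CompMixed(n,i,j) counts the compositions of n into i ones followed by j parts
-- that are powers of p greater than 1.
module PowerComposition (q : ℕ) (pr : Prime (suc (suc q))) where

  open import Data.Nat as N using (ℕ; zero; suc; _≤_; _<_; z≤n; s≤s; _∸_; _%_; _/_)
  import Data.Nat.Properties as NP
  open import Data.Nat.DivMod using (m%n<n; m*n/n≡m; m*[n/m]≡n)
  open import Data.Nat.Divisibility as ND using (divides)
  open import Data.Nat.Combinatorics using (_C_)
  open import Data.Integer hiding (suc; _≤_; _<_; _%_; _/_)
  open import Data.Integer.Properties
  open import Data.Integer.Tactic.RingSolver using (solve-∀)
  open import Data.Empty using (⊥-elim)
  open import Relation.Nullary using (Dec; yes; no; ¬_)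
  open import Relation.Binary.PropositionalEquality
  open FiniteSum
  open Binomial using (Σ-pascal)
  open LeadingTerm q pr public

  δdiv : ℕ → ℤ
  δdiv m = 𝟙 (p ND.∣? m)

  δdiv-yes : ∀ m → p ND.∣ m → δdiv m ≡ 1ℤ
  δdiv-yes m = 𝟙-yes (p ND.∣? m)

  δdiv-no : ∀ m → ¬ p ND.∣ m → δdiv m ≡ 0ℤ
  δdiv-no m = 𝟙-no (p ND.∣? m)

  δone : ℕ → ℤ
  δone a = 𝟙 (a N.≟ 1)

  δle : ℕ → ℕ → ℤ
  δle i n = 𝟙 (i N.≤? n)

  p*t/p : ∀ t → (p N.* t) / p ≡ t
  p*t/p t = trans (cong (_/ p) (NP.*-comm p t)) (m*n/n≡m t p)

  -- CompBig m j: compositions of m into j powers of p that are all at least p,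
  -- i.e. p·(compositions of m/p into j powers of p).
  CompBig : ℕ → ℕ → ℤ
  CompBig m j = δdiv m * Comp (m / p) j

  CompBig-p* : ∀ t j → CompBig (p N.* t) j ≡ Comp t j
  CompBig-p* t j = trans (cong₂ _*_ (δdiv-yes (p N.* t) (ND.m∣m*n t)) (cong (λ z → Comp z j) (p*t/p t))) (*-identityˡ _)

  CompBig-nondivisible : ∀ m j → ¬ p ND.∣ m → CompBig m j ≡ 0ℤ
  CompBig-nondivisible m j p∤m = cong (_* Comp (m / p) j) (δdiv-no m p∤m)

  -- CompMixed n i j: compositions of n into i ones followed by j powers of p that are at least p.
  CompMixed : ℕ → ℕ → ℕ → ℤ
  CompMixed n i j = δle i n * CompBig (n ∸ i) j

  CompMixed-yes : ∀ n i j → i ≤ n → CompMixed n i j ≡ CompBig (n ∸ i) j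
  CompMixed-yes n i j i≤n = trans (cong (_* CompBig (n ∸ i) j) (𝟙-yes (i N.≤? n) i≤n)) (*-identityˡ _)

  CompMixed-no : ∀ n i j → ¬ i ≤ n → CompMixed n i j ≡ 0ℤ
  CompMixed-no n i j i≰n = cong (_* CompBig (n ∸ i) j) (𝟙-no (i N.≤? n) i≰n)

  power-unit≡1 : ∀ a → σp a ≡ 1 → ¬ p ND.∣ a → a ≡ 1
  power-unit≡1 a σa≡1 p∤a = by-last-digit (a % p) (a / p) (digits a) (m%n<n a p)
    where
      by-last-digit : ∀ r t → a ≡ r N.+ p N.* t → r < p → a ≡ 1
      by-last-digit zero t a≡ _ = ⊥-elim (p∤a (subst (p ND.∣_) (sym a≡) (ND.m∣m*n t)))
      by-last-digit (suc zero) t a≡ r<p =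
        trans a≡ (cong suc (trans (cong (p N.*_) (σ≡0⇒≡0 t σt≡0)) (NP.*-zeroʳ p)))
        where σt≡0 : σp t ≡ 0
              σt≡0 = NP.suc-injective (trans (sym (σ-digit 1 t r<p)) (trans (cong σp (sym a≡)) σa≡1))
      by-last-digit (suc (suc r)) t a≡ r<p with () ← trans (sym σa≡1) (trans (cong σp a≡) (σ-digit (suc (suc r)) t r<p))

  δpow-split : ∀ a → δpow a ≡ δone a + δdiv a * δpow (a / p)
  δpow-split a with p ND.∣? a
  ... | yes p∣a = sym (begin
      δone a + 1ℤ * δpow (a / p)   ≡⟨ cong₂ _+_ (𝟙-no (a N.≟ 1) a≢1) (*-identityˡ _) ⟩
      0ℤ + δpow (a / p)            ≡⟨ +-identityˡ _ ⟩
      δpow (a / p)                 ≡⟨ cong (λ z → 𝟙 (z N.≟ 1)) (trans (sym (σ-p* (a / p))) (cong σp (m*[n/m]≡n p∣a))) ⟩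
      δpow a ∎)
    where open ≡-Reasoning
          a≢1 : a ≢ 1
          a≢1 refl = p∤1 p∣a
  ... | no p∤a = trans (by-one (a N.≟ 1)) (sym (+-identityʳ (δone a)))
    where
      by-one : Dec (a ≡ 1) → δpow a ≡ δone a
      by-one (yes refl) = δpow-yes 1 σ-one
      by-one (no a≢1) = trans (δpow-no a (λ σa≡1 → a≢1 (power-unit≡1 a σa≡1 p∤a))) (sym (𝟙-no (a N.≟ 1) a≢1))

  Σ-multiples : ∀ M (h : ℕ → ℤ) → Σ< (p N.* M) (λ b → δdiv b * h b) ≡ Σ< M (λ c → h (p N.* c))
  Σ-multiples zero h = cong (λ z → Σ< z (λ b → δdiv b * h b)) (NP.*-zeroʳ p)
  Σ-multiples (suc M) h = begin
      Σ< (p N.* suc M) g                                 ≡⟨ cong (λ z → Σ< z g) (trans (NP.*-suc p M) (NP.+-comm p (p N.* M))) ⟩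
      Σ< (p N.* M N.+ p) g                               ≡⟨ Σ-split (p N.* M) p g ⟩
      Σ< (p N.* M) g + Σ< p (λ r → g (p N.* M N.+ r))    ≡⟨ cong₂ _+_ (Σ-multiples M h) last-block ⟩
      Σ< M (λ c → h (p N.* c)) + h (p N.* M) ∎
    where
      open ≡-Reasoning
      g : ℕ → ℤ
      g = λ b → δdiv b * h b
      first : g (p N.* M N.+ 0) ≡ h (p N.* M)
      first = trans (cong g (NP.+-identityʳ (p N.* M))) (trans (cong (_* h (p N.* M)) (δdiv-yes (p N.* M) (ND.m∣m*n M))) (*-identityˡ _))
      others : ∀ r → r < suc q → g (p N.* M N.+ suc r) ≡ 0ℤ
      others r r<q = cong (_* h (p N.* M N.+ suc r)) (δdiv-no _ (subst (λ z → ¬ p ND.∣ z) (NP.+-comm (suc r) (p N.* M)) (p∤digit (suc r) M (s≤s z≤n) (s≤s r<q))))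
      last-block : Σ< p (λ r → g (p N.* M N.+ r)) ≡ h (p N.* M)
      last-block = trans (Σ-shift (suc q) (λ r → g (p N.* M N.+ r))) (trans (cong₂ _+_ first (Σ-zero (suc q) _ others)) (+-identityʳ _))

  CompBig-step : ∀ m j → Σ< m (λ b → δdiv (m ∸ b) * δpow ((m ∸ b) / p) * CompBig b j) ≡ CompBig m (suc j)
  CompBig-step m j = by-divisibility (p ND.∣? m)
   where
    Goal : Set
    Goal = Σ< m (λ b → δdiv (m ∸ b) * δpow ((m ∸ b) / p) * CompBig b j) ≡ CompBig m (suc j)
    by-divisibility : Dec (p ND.∣ m) → Goal
    by-divisibility (no p∤m) = trans (Σ-zero m _ term) (sym (CompBig-nondivisible m (suc j) p∤m))
     where
      -- m - b and b cannot both be multiples of p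
      term : ∀ b → b < m → δdiv (m ∸ b) * δpow ((m ∸ b) / p) * CompBig b j ≡ 0ℤ
      term b b<m = by-b (p ND.∣? b)
       where
        by-b : Dec (p ND.∣ b) → δdiv (m ∸ b) * δpow ((m ∸ b) / p) * CompBig b j ≡ 0ℤ
        by-b (no p∤b) = trans (cong (δdiv (m ∸ b) * δpow ((m ∸ b) / p) *_) (CompBig-nondivisible b j p∤b)) (*-zeroʳ (δdiv (m ∸ b) * δpow ((m ∸ b) / p)))
        by-b (yes p∣b) = cong (λ z → z * δpow ((m ∸ b) / p) * CompBig b j) (δdiv-no (m ∸ b) p∤m∸b)
          where p∤m∸b : ¬ p ND.∣ (m ∸ b)
                p∤m∸b p∣m∸b = p∤m (subst (p ND.∣_) (NP.m∸n+n≡m (NP.<⇒≤ b<m)) (ND.∣m∣n⇒∣m+n p∣m∸b p∣b))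
    by-divisibility (yes (divides M refl)) = begin
        Σ< (M N.* p) (λ b → δdiv (M N.* p ∸ b) * δpow ((M N.* p ∸ b) / p) * CompBig b j)
          ≡⟨ cong (λ z → Σ< z (λ b → δdiv (z ∸ b) * δpow ((z ∸ b) / p) * CompBig b j)) (NP.*-comm M p) ⟩
        Σ< (p N.* M) (λ b → δdiv (p N.* M ∸ b) * δpow ((p N.* M ∸ b) / p) * CompBig b j)
          ≡⟨ Σ-cong (p N.* M) (λ b _ → regroup (δdiv (p N.* M ∸ b)) (δpow ((p N.* M ∸ b) / p)) (δdiv b) (Comp (b / p) j)) ⟩
        Σ< (p N.* M) (λ b → δdiv b * h b)
          ≡⟨ Σ-multiples M h ⟩
        Σ< M (λ c → h (p N.* c))
          ≡⟨ Σ-cong M (λ c _ → h-multiple c) ⟩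
        Σ< M (λ c → δpow (M ∸ c) * Comp c j)
          ≡⟨ sym (CompBig-p* M (suc j)) ⟩
        CompBig (p N.* M) (suc j)
          ≡⟨ cong (λ z → CompBig z (suc j)) (NP.*-comm p M) ⟩
        CompBig (M N.* p) (suc j) ∎
      where
        open ≡-Reasoning
        h : ℕ → ℤ
        h = λ b → δdiv (p N.* M ∸ b) * δpow ((p N.* M ∸ b) / p) * Comp (b / p) j
        regroup : ∀ x y z t → x * y * (z * t) ≡ z * (x * y * t)
        regroup = solve-∀
        h-multiple : ∀ c → h (p N.* c) ≡ δpow (M ∸ c) * Comp c j
        h-multiple c = begin
          δdiv (p N.* M ∸ p N.* c) * δpow ((p N.* M ∸ p N.* c) / p) * Comp ((p N.* c) / p) j
            ≡⟨ cong (λ z → δdiv z * δpow (z / p) * Comp ((p N.* c) / p) j) (sym (NP.*-distribˡ-∸ p M c)) ⟩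
          δdiv (p N.* (M ∸ c)) * δpow ((p N.* (M ∸ c)) / p) * Comp ((p N.* c) / p) j
            ≡⟨ cong₂ (λ x y → x * δpow y * Comp ((p N.* c) / p) j) (δdiv-yes (p N.* (M ∸ c)) (ND.m∣m*n (M ∸ c))) (p*t/p (M ∸ c)) ⟩
          1ℤ * δpow (M ∸ c) * Comp ((p N.* c) / p) j
            ≡⟨ cong₂ (λ x y → x * Comp y j) (*-identityˡ (δpow (M ∸ c))) (p*t/p c) ⟩
          δpow (M ∸ c) * Comp c j ∎

  -- Peeling a first part equal to 1 (only possible when it is the last remaining 1).
  CompMixed-step-one : ∀ n i j → Σ< n (λ b → δone (n ∸ b) * CompMixed b i j) ≡ CompMixed n (suc i) j
  CompMixed-step-one zero    i j = sym (CompMixed-no 0 (suc i) j (λ ()))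
  CompMixed-step-one (suc n) i j = begin
      Σ< n (λ b → δone (suc n ∸ b) * CompMixed b i j) + δone (suc n ∸ n) * CompMixed n i j
        ≡⟨ cong₂ _+_ (Σ-zero n _ not-last) (trans (cong (λ z → δone z * CompMixed n i j) (NP.m+n∸n≡m 1 n)) (*-identityˡ _)) ⟩
      0ℤ + CompMixed n i j
        ≡⟨ +-identityˡ _ ⟩
      δle i n * CompBig (n ∸ i) j
        ≡⟨ cong (_* CompBig (n ∸ i) j) (δle-suc i n) ⟩
      CompMixed (suc n) (suc i) j ∎
    where
      open ≡-Reasoning
      δle-suc : ∀ i n → δle i n ≡ δle (suc i) (suc n)
      δle-suc i n with i N.≤? n
      ... | yes i≤n = sym (𝟙-yes (suc i N.≤? suc n) (s≤s i≤n))
      ... | no i≰n = sym (𝟙-no (suc i N.≤? suc n) (λ i+1≤n+1 → i≰n (NP.≤-pred i+1≤n+1)))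
      not-last : ∀ b → b < n → δone (suc n ∸ b) * CompMixed b i j ≡ 0ℤ
      not-last b b<n = cong (_* CompMixed b i j) (𝟙-no (suc n ∸ b N.≟ 1) ≢1)
        where ≢1 : suc n ∸ b ≢ 1
              ≢1 eq = NP.m>n⇒m∸n≢0 b<n (NP.suc-injective (trans (sym (NP.+-∸-assoc 1 (NP.<⇒≤ b<n))) eq))

  CompMixed-big : ∀ n i j → CompMixed n i (suc j) ≡ CompBig (n ∸ i) (suc j)
  CompMixed-big n i j with i N.≤? n
  ... | yes _ = *-identityˡ _
  ... | no i≰n = sym (trans (cong (λ z → CompBig z (suc j)) (NP.m≤n⇒m∸n≡0 (NP.<⇒≤ (NP.≰⇒> i≰n)))) (*-zeroʳ (δdiv 0)))

  -- Peeling a first part p·(power of p); the i parts equal to 1 come first and are skipped.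
  CompMixed-step-big : ∀ n i j → Σ< n (λ b → δdiv (n ∸ b) * δpow ((n ∸ b) / p) * CompMixed b i j) ≡ CompMixed n i (suc j)
  CompMixed-step-big n i j = begin
      Σ< n (λ b → δdiv (n ∸ b) * δpow ((n ∸ b) / p) * CompMixed b i j)
        ≡⟨ Σ-drop n i _ (λ b b<i → trans (cong (δdiv (n ∸ b) * δpow ((n ∸ b) / p) *_) (CompMixed-no b i j (NP.<⇒≱ b<i))) (*-zeroʳ (δdiv (n ∸ b) * δpow ((n ∸ b) / p)))) ⟩
      Σ< (n ∸ i) (λ b → δdiv (n ∸ (i N.+ b)) * δpow ((n ∸ (i N.+ b)) / p) * CompMixed (i N.+ b) i j)
        ≡⟨ Σ-cong (n ∸ i) (λ b _ → cong₂ (λ x y → δdiv x * δpow (x / p) * y) (sym (NP.∸-+-assoc n i b))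
                                    (trans (CompMixed-yes (i N.+ b) i j (NP.m≤m+n i b)) (cong (λ z → CompBig z j) (NP.m+n∸m≡n i b)))) ⟩
      Σ< (n ∸ i) (λ b → δdiv ((n ∸ i) ∸ b) * δpow (((n ∸ i) ∸ b) / p) * CompBig b j)
        ≡⟨ CompBig-step (n ∸ i) j ⟩
      CompBig (n ∸ i) (suc j)
        ≡⟨ sym (CompMixed-big n i j) ⟩
      CompMixed n i (suc j) ∎
    where open ≡-Reasoning

  -- Peeling off the first part of a composition, which is either 1 or p·(power of p).
  CompMixed-step : ∀ n i j → Σ< n (λ b → δpow (n ∸ b) * CompMixed b i j) ≡ CompMixed n (suc i) j + CompMixed n i (suc j)
  CompMixed-step n i j =
    trans (Σ-cong n (λ b _ → trans (cong (_* CompMixed b i j) (δpow-split (n ∸ b))) (*-distribʳ-+ (CompMixed b i j) (δone (n ∸ b)) _)))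
          (trans (Σ-+ n _ _) (cong₂ _+_ (CompMixed-step-one n i j) (CompMixed-step-big n i j)))

  Comp-no-parts : ∀ n → Comp n 0 ≡ CompBig n 0
  Comp-no-parts zero    = sym (*-identityˡ 1ℤ)
  Comp-no-parts (suc n) with p ND.∣? suc n
  ... | no _ = refl
  ... | yes p∣n+1 = sym (trans (*-identityˡ _) (Comp-positive (suc n / p) quotient≢0))
    where
      Comp-positive : ∀ m → m ≢ 0 → Comp m 0 ≡ 0ℤ
      Comp-positive zero    m≢0 = ⊥-elim (m≢0 refl)
      Comp-positive (suc m) _   = refl
      quotient≢0 : suc n / p ≢ 0
      quotient≢0 eq with () ← trans (sym (m*[n/m]≡n p∣n+1)) (trans (cong (p N.*_) eq) (NP.*-zeroʳ p))

  -- Choosing the positions of the parts equal to 1: Comp(n,k) = Σ_i C(k,i)·CompMixed(n,i,k-i).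
  Comp-by-ones : ∀ k n → Comp n k ≡ Σ< (suc k) (λ i → + (k C i) * CompMixed n i (k ∸ i))
  Comp-by-ones zero n = sym (trans (+-identityˡ _) (trans (*-identityˡ _) (trans (CompMixed-yes n 0 0 z≤n) (sym (Comp-no-parts n)))))
  Comp-by-ones (suc k) n = begin
      Σ< n (λ b → δpow (n ∸ b) * Comp b k)
        ≡⟨ Σ-cong n (λ b _ → trans (cong (δpow (n ∸ b) *_) (Comp-by-ones k b))
                                   (trans (sym (Σ-*ˡ (suc k) (δpow (n ∸ b)) _)) (Σ-cong (suc k) (λ i _ → swap (δpow (n ∸ b)) (+ (k C i)) (CompMixed b i (k ∸ i)))))) ⟩
      Σ< n (λ b → Σ< (suc k) (λ i → + (k C i) * (δpow (n ∸ b) * CompMixed b i (k ∸ i))))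
        ≡⟨ Σ-swap n (suc k) (λ i b → + (k C i) * (δpow (n ∸ b) * CompMixed b i (k ∸ i))) ⟩
      Σ< (suc k) (λ i → Σ< n (λ b → + (k C i) * (δpow (n ∸ b) * CompMixed b i (k ∸ i))))
        ≡⟨ Σ-cong (suc k) (λ i _ → trans (Σ-*ˡ n (+ (k C i)) _) (trans (cong (+ (k C i) *_) (CompMixed-step n i (k ∸ i))) (*-distribˡ-+ (+ (k C i)) _ _))) ⟩
      Σ< (suc k) (λ i → + (k C i) * CompMixed n (suc i) (k ∸ i) + + (k C i) * CompMixed n i (suc (k ∸ i)))
        ≡⟨ trans (Σ-+ (suc k) _ _) (+-comm (Σ< (suc k) (λ i → + (k C i) * CompMixed n (suc i) (k ∸ i))) _) ⟩
      Σ< (suc k) (λ i → + (k C i) * CompMixed n i (suc (k ∸ i))) + Σ< (suc k) (λ i → + (k C i) * CompMixed n (suc i) (k ∸ i))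
        ≡⟨ cong (_+ Σ< (suc k) (λ i → + (k C i) * CompMixed n (suc i) (k ∸ i)))
                (Σ-cong (suc k) (λ i i≤k → cong (λ z → + (k C i) * CompMixed n i z) (sym (NP.+-∸-assoc 1 (NP.≤-pred i≤k))))) ⟩
      Σ< (suc k) (λ i → + (k C i) * CompMixed n i (suc k ∸ i)) + Σ< (suc k) (λ i → + (k C i) * CompMixed n (suc i) (k ∸ i))
        ≡⟨ sym (Σ-pascal k (λ i → CompMixed n i (suc k ∸ i))) ⟩
      Σ< (suc (suc k)) (λ i → + (suc k C i) * CompMixed n i (suc k ∸ i)) ∎
    where
      open ≡-Reasoning
      swap : ∀ x y z → x * (y * z) ≡ y * (x * z)
      swap = solve-∀

-- In the expansion Comp(N, pj) = Σ_i C(pj,i)·CompMixed(N,i,pj-i) only the terms with p ∣ i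
-- survive modulo p (Lucas), and for those C(pj,pc) ≡ C(j,c) while the counts scale by p.
module CompositionScaling (q : ℕ) (pr : Prime (suc (suc q))) where

  open import Data.Nat as N using (ℕ; zero; suc; _≤_; _<_; z≤n; s≤s; _∸_; _/_)
  import Data.Nat.Properties as NP
  open import Data.Nat.DivMod using (m<n⇒m/n≡0)
  open import Data.Nat.Divisibility as ND using (divides)
  open import Data.Nat.Induction using (<-rec)
  open import Data.Nat.Primality using (euclidsLemma)
  open import Data.Nat.Combinatorics using (_C_; k>n⇒nCk≡0)
  open import Data.Integer hiding (suc; _≤_; _<_; _/_)
  open import Data.Integer.Properties
  open import Data.Integer.Tactic.RingSolver using (solve-∀)
  import Data.Nat.Tactic.RingSolver as NS
  open import Data.Sum using (inj₁; inj₂)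
  open import Data.Empty using (⊥-elim)
  open import Relation.Nullary using (Dec; yes; no; ¬_)
  open import Relation.Binary.PropositionalEquality
  open FiniteSum
  open Binomial using (absorption)
  open PowerComposition q pr public

  -- p ∣ C(pj, i) when p ∤ i, by absorption C(n+1,i+1)·(i+1) = (n+1)·C(n,i).
  binomial-p∣ : ∀ j i → ¬ p ND.∣ i → Cg 1 (+ ((p N.* j) C i)) 0ℤ
  binomial-p∣ j i p∤i with i N.≤? p N.* j
  ... | no i≰pj = cg-≡ (cong +_ (k>n⇒nCk≡0 (NP.≰⇒> i≰pj)))
  ... | yes i≤pj = cg-dvdℕ _ (subst (ND._∣ ((p N.* j) C i)) (sym (NP.*-identityʳ p)) (p∣ i (p N.* j) refl i≤pj p∤i))
    where
      p∣ : ∀ i n → n ≡ p N.* j → i ≤ n → ¬ p ND.∣ i → p ND.∣ (n C i)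
      p∣ zero     n       _  _          p∤0 = ⊥-elim (p∤0 (divides 0 refl))
      p∣ (suc i′) (suc n′) n≡ (s≤s i′≤n′) p∤i with euclidsLemma (suc n′ C suc i′) (suc i′) pr
           (subst (p ND.∣_) (sym (absorption n′ i′ i′≤n′)) (ND.∣m⇒∣m*n (n′ C i′) (subst (p ND.∣_) (sym n≡) (ND.m∣m*n j))))
      ... | inj₁ p∣C = p∣C
      ... | inj₂ p∣i = ⊥-elim (p∤i p∣i)

  binomial-p*-carries : ∀ a b → BinomialValuation.β (p N.* a) (p N.* b) ≡ BinomialValuation.β a b
  binomial-p*-carries a b = NP.+-cancelʳ-≡ (b N.+ ν! b N.+ (a N.+ ν! a)) _ _ (begin
      Big.β N.+ (b N.+ ν! b N.+ (a N.+ ν! a))              ≡⟨ NP.+-comm Big.β _ ⟩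
      b N.+ ν! b N.+ (a N.+ ν! a) N.+ Big.β                ≡⟨ cong₂ (λ x y → x N.+ y N.+ Big.β) (sym (ν!-p* b)) (sym (ν!-p* a)) ⟩
      ν! (p N.* b) N.+ ν! (p N.* a) N.+ Big.β              ≡⟨ regroup (ν! (p N.* b)) (ν! (p N.* a)) Big.β ⟩
      Big.β N.+ (ν! (p N.* b) N.+ ν! (p N.* a))            ≡⟨ sym Big.ν!-split ⟩
      ν! (p N.* a N.+ p N.* b)                             ≡⟨ cong ν! (sym (NP.*-distribˡ-+ p a b)) ⟩
      ν! (p N.* (a N.+ b))                                 ≡⟨ ν!-p* (a N.+ b) ⟩
      a N.+ b N.+ ν! (a N.+ b)                             ≡⟨ cong (a N.+ b N.+_) Small.ν!-split ⟩
      a N.+ b N.+ (Small.β N.+ (ν! b N.+ ν! a))            ≡⟨ regroup′ a b Small.β (ν! b) (ν! a) ⟩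
      Small.β N.+ (b N.+ ν! b N.+ (a N.+ ν! a)) ∎)
    where
      open ≡-Reasoning
      module Small = BinomialValuation a b
      module Big = BinomialValuation (p N.* a) (p N.* b)
      regroup : ∀ x y z → x N.+ y N.+ z ≡ z N.+ (x N.+ y)
      regroup = NS.solve-∀
      regroup′ : ∀ a b c x y → a N.+ b N.+ (c N.+ (x N.+ y)) ≡ c N.+ (b N.+ x N.+ (a N.+ y))
      regroup′ = NS.solve-∀

  -- The unit parts of C(pa+pb, pb) and C(a+b, b) agree modulo p: compute ε_p((p(a+b))!)
  -- through the binomial factorisation and through ε_p((pn)!) ≡ ε_p(n!)·c!^n, then cancel.
  binomial-p*-units : ∀ a b → Cg 1 (+ εp (BinomialValuation.binom (p N.* a) (p N.* b))) (+ εp (BinomialValuation.binom a b))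
  binomial-p*-units a b = cg-cancel u unit-u
      (cg-trans (cg-≡ eqL)
        (cg-trans (cg-sym (cg-*l εbig (cg-* (ε!-p* b) (ε!-p* a))))
          (cg-trans (cg-sym (cg-≡ big-units)) (cg-trans (ε!-p* n) (cg-≡ eqR)))))
    where
      module Small = BinomialValuation a b
      module Big = BinomialValuation (p N.* a) (p N.* b)
      n : ℕ
      n = a N.+ b
      εbig εsmall u : ℤ
      εbig = + εp Big.binom
      εsmall = + εp Small.binom
      u = + ε! b * + ε! a * c! ^ n
      unit-u : Unit u
      unit-u = unit-* (+ ε! b * + ε! a) (c! ^ n) (unit-* (+ ε! b) (+ ε! a) (p∤ε! b) (p∤ε! a)) (unit-^ c! n (p∤ε! (suc q)))
      big-units : + ε! (p N.* n) ≡ εbig * (+ ε! (p N.* b) * + ε! (p N.* a))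
      big-units = trans (cong (λ z → + ε! z) (NP.*-distribˡ-+ p a b))
                    (trans (cong +_ Big.ε!-split) (trans (pos-* (εp Big.binom) _) (cong (εbig *_) (pos-* (ε! (p N.* b)) (ε! (p N.* a))))))
      eqL : u * εbig ≡ εbig * ((+ ε! b * c! ^ b) * (+ ε! a * c! ^ a))
      eqL = trans (cong (λ z → + ε! b * + ε! a * z * εbig) (^-distribˡ-+-* c! a b))
                  (regroup (+ ε! b) (+ ε! a) (c! ^ a) (c! ^ b) εbig)
        where regroup : ∀ x y z t e → x * y * (z * t) * e ≡ e * ((x * t) * (y * z))
              regroup = solve-∀
      eqR : + ε! n * c! ^ n ≡ u * εsmall
      eqR = trans (cong (_* c! ^ n) (trans (cong +_ Small.ε!-split) (trans (pos-* (εp Small.binom) _) (cong (εsmall *_) (pos-* (ε! b) (ε! a))))))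
                  (regroup εsmall (+ ε! b) (+ ε! a) (c! ^ n))
        where regroup : ∀ e x y z → e * (x * y) * z ≡ x * y * z * e
              regroup = solve-∀

  -- C(pa+pb, pb) ≡ C(a+b, b) (mod p), from equal carries and congruent unit parts.
  binomial-scale′ : ∀ a b → Cg 1 (+ BinomialValuation.binom (p N.* a) (p N.* b)) (+ BinomialValuation.binom a b)
  binomial-scale′ a b = cg-weak≤ (NP.m≤n+m 1 Small.β)
      (subst₂ (Cg (Small.β N.+ 1)) (sym big-factor) (sym (trans Small.binom-factor (*-comm _ (P^ Small.β))))
              (cg-scale Small.β (binomial-p*-units a b)))
    where
      module Small = BinomialValuation a b
      module Big = BinomialValuation (p N.* a) (p N.* b)
      big-factor : + Big.binom ≡ P^ Small.β * + εp Big.binom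
      big-factor = trans Big.binom-factor (trans (*-comm (+ εp Big.binom) _) (cong (λ z → P^ z * + εp Big.binom) (binomial-p*-carries a b)))

  binomial-scale : ∀ j c → c ≤ j → Cg 1 (+ ((p N.* j) C (p N.* c))) (+ (j C c))
  binomial-scale j c c≤j = subst₂ (λ x y → Cg 1 (+ (x C (p N.* c))) (+ (y C c))) pj≡ (NP.m∸n+n≡m c≤j) (binomial-scale′ (j ∸ c) c)
    where pj≡ : p N.* (j ∸ c) N.+ p N.* c ≡ p N.* j
          pj≡ = trans (sym (NP.*-distribˡ-+ p (j ∸ c) c)) (cong (p N.*_) (NP.m∸n+n≡m c≤j))

  PartsBelow : ℕ → Set
  PartsBelow N = ∀ {M} → M < N → ∀ j → Cg 1 (Comp M (p N.* j)) (CompBig M j)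

  CompMixed-scale : ∀ N c j′ → 0 < N → PartsBelow N →
                    Cg 1 (CompMixed N (p N.* c) (p N.* j′)) (δdiv N * CompMixed (N / p) c j′)
  CompMixed-scale N c j′ N>0 ih with p ND.∣? N
  ... | no p∤N = cg-≡ (by-ones (p N.* c N.≤? N))
    where
      -- the big parts add up to a multiple of p, so with p ∤ N there is no room for them
      by-ones : Dec (p N.* c ≤ N) → CompMixed N (p N.* c) (p N.* j′) ≡ 0ℤ
      by-ones (no pc≰N) = CompMixed-no N (p N.* c) (p N.* j′) pc≰N
      by-ones (yes pc≤N) = trans (CompMixed-yes N (p N.* c) (p N.* j′) pc≤N)
        (CompBig-nondivisible (N ∸ p N.* c) (p N.* j′) (λ p∣ → p∤N (subst (p ND.∣_) (NP.m∸n+n≡m pc≤N) (ND.∣m∣n⇒∣m+n p∣ (ND.m∣m*n c)))))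
  ... | yes (divides M refl) = cg-trans (subst (λ z → Cg 1 (CompMixed z (p N.* c) (p N.* j′)) (CompMixed M c j′)) (NP.*-comm p M) (by-ones (c N.≤? M)))
                                        (cg-≡ (sym (trans (*-identityˡ _) (cong (λ z → CompMixed z c j′) (trans (cong (_/ p) (NP.*-comm M p)) (p*t/p M))))))
    where
      M>0 : 0 < M
      M>0 = NP.n≢0⇒n>0 (λ M≡0 → NP.<⇒≢ N>0 (sym (cong (N._* p) M≡0)))
      by-ones : Dec (c ≤ M) → Cg 1 (CompMixed (p N.* M) (p N.* c) (p N.* j′)) (CompMixed M c j′)
      by-ones (no c≰M) = cg-≡ (trans (CompMixed-no (p N.* M) (p N.* c) (p N.* j′) (λ pc≤pM → c≰M (NP.*-cancelˡ-≤ p pc≤pM))) (sym (CompMixed-no M c j′ c≰M)))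
      by-ones (yes c≤M) =
        cg-trans (cg-≡ (trans (CompMixed-yes (p N.* M) (p N.* c) (p N.* j′) (NP.*-monoʳ-≤ p c≤M))
                              (trans (cong (λ z → CompBig z (p N.* j′)) (sym (NP.*-distribˡ-∸ p M c))) (CompBig-p* (M ∸ c) (p N.* j′)))))
                 (cg-trans (ih M∸c<N j′) (cg-≡ (sym (CompMixed-yes M c j′ c≤M))))
        where
          M∸c<N : M ∸ c < M N.* p
          M∸c<N = NP.≤-<-trans (NP.m∸n≤m M c) (NP.m<m*n M p {{N.>-nonZero M>0}} (s≤s (s≤s z≤n)))

  Comp-p-parts : ∀ N j → Cg 1 (Comp N (p N.* j)) (CompBig N j)
  Comp-p-parts = <-rec _ step
    where
      0/p≡0 : 0 / p ≡ 0
      0/p≡0 = m<n⇒m/n≡0 {0} {p} (s≤s z≤n)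
      step : ∀ N → PartsBelow N → ∀ j → Cg 1 (Comp N (p N.* j)) (CompBig N j)
      step zero _ zero =
        cg-≡ (trans (cong (Comp 0) (NP.*-zeroʳ p)) (sym (trans (cong₂ (λ x y → x * Comp y 0) (δdiv-yes 0 (divides 0 refl)) 0/p≡0) refl)))
      step zero _ (suc j) = cg-≡ (sym (trans (cong (λ y → δdiv 0 * Comp y (suc j)) 0/p≡0) (*-zeroʳ (δdiv 0))))
      step N@(suc _) ih j =
        cg-trans (cg-≡ (Comp-by-ones (p N.* j) N))
          (cg-trans (cg-+ (cg-trans (Σ-cg (p N.* j) term (λ i → δdiv i * term i) lucas) (cg-≡ (Σ-multiples j term))) (cg-refl 1 (term (p N.* j))))
            (cg-trans (Σ-cg (suc j) (λ c → term (p N.* c)) (λ c → + (j C c) * (δdiv N * CompMixed (N / p) c (j ∸ c))) multiples)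
              (cg-≡ refold)))
        where
          term : ℕ → ℤ
          term i = + ((p N.* j) C i) * CompMixed N i (p N.* j ∸ i)
          lucas : ∀ i → i < p N.* j → Cg 1 (term i) (δdiv i * term i)
          lucas i _ with p ND.∣? i
          ... | yes _ = cg-≡ (sym (*-identityˡ (term i)))
          ... | no p∤i = cg0-*r (CompMixed N i (p N.* j ∸ i)) (binomial-p∣ j i p∤i)
          multiples : ∀ c → c < suc j → Cg 1 (term (p N.* c)) (+ (j C c) * (δdiv N * CompMixed (N / p) c (j ∸ c)))
          multiples c c≤j = cg-* (binomial-scale j c (NP.≤-pred c≤j))
            (subst (λ z → Cg 1 (CompMixed N (p N.* c) z) (δdiv N * CompMixed (N / p) c (j ∸ c))) (NP.*-distribˡ-∸ p j c)
                   (CompMixed-scale N c (j ∸ c) (s≤s z≤n) ih))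
          refold : Σ< (suc j) (λ c → + (j C c) * (δdiv N * CompMixed (N / p) c (j ∸ c))) ≡ CompBig N j
          refold = trans (Σ-cong (suc j) (λ c _ → swap (+ (j C c)) (δdiv N) (CompMixed (N / p) c (j ∸ c))))
                         (trans (Σ-*ˡ (suc j) (δdiv N) _) (cong (δdiv N *_) (sym (Comp-by-ones j (N / p)))))
            where swap : ∀ x y z → x * (y * z) ≡ y * (x * z)
                  swap = solve-∀

  Comp-scale : ∀ n k → Cg 1 (Comp (p N.* n) (p N.* k)) (Comp n k)
  Comp-scale n k = cg-trans (Comp-p-parts (p N.* n) k) (cg-≡ (CompBig-p* n k))

module StirlingScaling (q : ℕ) (pr : Prime (suc (suc q))) where

  open import Defs using (S)
  open import Data.Nat as N using (ℕ; zero; suc; _≤_; _!; _∸_)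
  import Data.Nat.Properties as NP
  open import Data.Integer hiding (suc; _≤_)
  open import Data.Integer.Properties
  import Data.Integer.Divisibility.Signed as ZD
  open import Data.Integer.Tactic.RingSolver using (solve-∀)
  import Data.Nat.Tactic.RingSolver as NS
  open import Data.Product using (Σ; _×_; _,_; proj₁; proj₂)
  open import Relation.Nullary using (yes; no)
  open import Relation.Binary.PropositionalEquality
  open Stirling using (S-vanishes)
  open CompositionScaling q pr public

  -- The number M with (p-1)·M = n - k: with L = ν_p(k!) + m we have (p-1)·(L + M) = n - σ_p(n).
  leading-M : ℕ → ℕ → ℕ → ℕ
  leading-M n k m = ν! n ∸ (ν! k N.+ m)

  leading-L : ∀ n k m → suc q N.* m N.+ σp n ≡ σp k → suc q N.* (ν! k N.+ m) N.+ σp n ≡ k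
  leading-L n k m h = trans (regroup (suc q) (ν! k) m (σp n)) (trans (cong (suc q N.* ν! k N.+_) h) (legendre k))
    where regroup : ∀ c x y z → c N.* (x N.+ y) N.+ z ≡ c N.* x N.+ (c N.* y N.+ z)
          regroup = NS.solve-∀

  leading-M-spec : ∀ n k m → k ≤ n → suc q N.* m N.+ σp n ≡ σp k → suc q N.* leading-M n k m N.+ k ≡ n
  leading-M-spec n k m k≤n h = begin
      suc q N.* M N.+ k                                 ≡⟨ cong (suc q N.* M N.+_) (sym (leading-L n k m h)) ⟩
      suc q N.* M N.+ (suc q N.* L N.+ σp n)            ≡⟨ regroup (suc q) M L (σp n) ⟩
      suc q N.* (M N.+ L) N.+ σp n                      ≡⟨ cong (λ z → suc q N.* z N.+ σp n) (NP.m∸n+n≡m L≤ν!n) ⟩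
      suc q N.* ν! n N.+ σp n                           ≡⟨ legendre n ⟩
      n ∎
    where
      open ≡-Reasoning
      L M : ℕ
      L = ν! k N.+ m
      M = leading-M n k m
      L≤ν!n : L ≤ ν! n
      L≤ν!n = NP.*-cancelˡ-≤ (suc q) (NP.+-cancelʳ-≤ (σp n) _ _ (subst₂ _≤_ (sym (leading-L n k m h)) (sym (legendre n)) k≤n))
      regroup : ∀ c x y z → c N.* x N.+ (c N.* y N.+ z) ≡ c N.* (x N.+ y) N.+ z
      regroup = NS.solve-∀

  -- The leading term of S(n,k) itself: if (p-1)·m = σ_p(k) - σ_p(n) and k ≤ n, then
  -- ε_p(k!)·c!^M·S(n,k) ≡ p^m·ε_p(n!)·Comp(n,k)  (mod p^(m+1)), dividing the leading-term
  -- congruence for F(n,k) = k!·S(n,k) by p^ν_p(k!).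
  S-leading : ∀ n k m → k ≤ n → suc q N.* m N.+ σp n ≡ σp k →
              Cg (suc m) (+ ε! k * c! ^ leading-M n k m * + S n k) (P^ m * (+ ε! n * Comp n k))
  S-leading n k m k≤n h = cg-unscale (ν! k) (subst₂ (Cg (ν! k N.+ suc m)) eqF eqC (subst (λ z → Cg z (+ Stirling.F n k * c! ^ M) (P^ L * + ε! n * Comp n k)) (sym (NP.+-suc (ν! k) m)) lead))
    where
      L M : ℕ
      L = ν! k N.+ m
      M = leading-M n k m
      lead : Cg (suc L) (+ Stirling.F n k * c! ^ M) (P^ L * + ε! n * Comp n k)
      lead = leading-term k n L M (leading-L n k m h) (leading-M-spec n k m k≤n h)
      -- F(n,k) = k!·S(n,k) and k! = p^ν!(k)·ε!(k)
      eqF : + Stirling.F n k * c! ^ M ≡ P^ (ν! k) * (+ ε! k * c! ^ M * + S n k)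
      eqF = trans (cong (_* c! ^ M) (trans (pos-* (k !) (S n k)) (cong (_* + S n k) k!≡)))
                  (regroup (P^ (ν! k)) (+ ε! k) (+ S n k) (c! ^ M))
        where
          k!≡ : + (k !) ≡ P^ (ν! k) * + ε! k
          k!≡ = trans (cong +_ (proj₁ (factorisation (k !) {{k NP.!≢0}}))) (pos-* (p N.^ ν! k) (ε! k))
          regroup : ∀ a b c d → a * b * c * d ≡ a * (b * d * c)
          regroup = solve-∀
      eqC : P^ L * + ε! n * Comp n k ≡ P^ (ν! k) * (P^ m * (+ ε! n * Comp n k))
      eqC = trans (cong (λ z → z * + ε! n * Comp n k) (P^-+ (ν! k) m)) (regroup (P^ (ν! k)) (P^ m) (+ ε! n) (Comp n k))
        where regroup : ∀ a b c d → a * b * c * d ≡ a * (b * (c * d))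
              regroup = solve-∀

  unit-multiple : ∀ m u x Y → Unit u → Cg (suc m) (u * x) (P^ m * Y) →
                  Σ ℤ λ s → x ≡ s * P^ m × Cg 1 (u * s) Y
  unit-multiple m u x Y unit-u h = s , x≡ , cg-unscale m (subst₂ (Cg (m N.+ 1)) (regroup′ u s (P^ m)) refl h′)
    where
      divisible : Cg m x 0ℤ
      divisible = cg-cancel u unit-u (cg-trans (cg-weak 1 h) (cg-trans (cg-dvd (P^ m * Y) Y (*-comm (P^ m) Y)) (cg-≡ (sym (*-zeroʳ u)))))
      s : ℤ
      s = ZD._∣_.quotient (cg0⇒dvd divisible)
      x≡ : x ≡ s * P^ m
      x≡ = ZD._∣_.equality (cg0⇒dvd divisible)
      h′ : Cg (m N.+ 1) (u * (s * P^ m)) (P^ m * Y)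
      h′ = subst₂ (λ z w → Cg z (u * w) (P^ m * Y)) (NP.+-comm 1 m) x≡ h
      regroup′ : ∀ a b c → a * (b * c) ≡ c * (a * b)
      regroup′ = solve-∀

  unit-scale : ∀ k M → Cg 1 (+ ε! (p N.* k) * c! ^ (p N.* M)) (+ ε! k * c! ^ (k N.+ p N.* M))
  unit-scale k M = cg-trans (cg-*r (c! ^ (p N.* M)) (ε!-p* k))
                            (cg-≡ (trans (*-assoc (+ ε! k) (c! ^ k) _) (cong (+ ε! k *_) (sym (^-distribˡ-+-* c! k (p N.* M))))))

  count-scale : ∀ n k → Cg 1 (+ ε! (p N.* n) * Comp (p N.* n) (p N.* k)) (c! ^ n * (+ ε! n * Comp n k))
  count-scale n k = cg-trans (cg-* (ε!-p* n) (Comp-scale n k)) (cg-≡ (regroup (+ ε! n) (c! ^ n) (Comp n k)))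
    where regroup : ∀ a b c → a * b * c ≡ b * (a * c)
          regroup = solve-∀

  unit-εc : ∀ a e → Unit (+ ε! a * c! ^ e)
  unit-εc a e = unit-* (+ ε! a) (c! ^ e) (p∤ε! a) (unit-^ c! e (p∤ε! (suc q)))

  exponent-p* : ∀ m n k → suc q N.* m N.+ σp n ≡ σp k → suc q N.* m N.+ σp (p N.* n) ≡ σp (p N.* k)
  exponent-p* m n k h = trans (cong (suc q N.* m N.+_) (σ-p* n)) (trans h (sym (σ-p* k)))

  leading-M-p* : ∀ n k m → k ≤ n → suc q N.* m N.+ σp n ≡ σp k → leading-M (p N.* n) (p N.* k) m ≡ p N.* leading-M n k m
  leading-M-p* n k m k≤n h = NP.*-cancelˡ-≡ _ (p N.* M) (suc q) (NP.+-cancelʳ-≡ (p N.* k) _ _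
      (trans (leading-M-spec (p N.* n) (p N.* k) m (NP.*-monoʳ-≤ p k≤n) (exponent-p* m n k h))
             (trans (cong (p N.*_) (sym (leading-M-spec n k m k≤n h))) (regroup p (suc q) M k))))
    where
      M : ℕ
      M = leading-M n k m
      regroup : ∀ a b c d → a N.* (b N.* c N.+ d) ≡ b N.* (a N.* c) N.+ a N.* d
      regroup = NS.solve-∀

  -- Comparing the leading terms of S(n,k) and S(pn,pk): writing S(n,k) = s·p^m and
  -- S(pn,pk) = s′·p^m, the unit and count factors scale compatibly, so s′ ≡ s (mod p).
  S-scale-leading : ∀ n k m → k ≤ n → suc q N.* m N.+ σp n ≡ σp k → Cg (suc m) (+ S (p N.* n) (p N.* k)) (+ S n k)
  S-scale-leading n k m k≤n h =
    subst₂ (Cg (suc m)) (trans (*-comm (P^ m) s′) (sym S′≡)) (trans (*-comm (P^ m) s) (sym S≡))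
      (subst (λ z → Cg z (P^ m * s′) (P^ m * s)) (NP.+-comm m 1) (cg-scale m s′≡s))
    where
      M : ℕ
      M = leading-M n k m
      lead′ : Cg (suc m) (+ ε! (p N.* k) * c! ^ (p N.* M) * + S (p N.* n) (p N.* k)) (P^ m * (+ ε! (p N.* n) * Comp (p N.* n) (p N.* k)))
      lead′ = subst (λ z → Cg (suc m) (+ ε! (p N.* k) * c! ^ z * + S (p N.* n) (p N.* k)) (P^ m * (+ ε! (p N.* n) * Comp (p N.* n) (p N.* k))))
                    (leading-M-p* n k m k≤n h) (S-leading (p N.* n) (p N.* k) m (NP.*-monoʳ-≤ p k≤n) (exponent-p* m n k h))
      factor : Σ ℤ λ s → + S n k ≡ s * P^ m × Cg 1 (+ ε! k * c! ^ M * s) (+ ε! n * Comp n k)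
      factor = unit-multiple m (+ ε! k * c! ^ M) (+ S n k) (+ ε! n * Comp n k) (unit-εc k M) (S-leading n k m k≤n h)
      factor′ : Σ ℤ λ s → + S (p N.* n) (p N.* k) ≡ s * P^ m × Cg 1 (+ ε! (p N.* k) * c! ^ (p N.* M) * s) (+ ε! (p N.* n) * Comp (p N.* n) (p N.* k))
      factor′ = unit-multiple m (+ ε! (p N.* k) * c! ^ (p N.* M)) (+ S (p N.* n) (p N.* k)) (+ ε! (p N.* n) * Comp (p N.* n) (p N.* k))
                              (unit-εc (p N.* k) (p N.* M)) lead′
      s s′ : ℤ
      s = proj₁ factor
      s′ = proj₁ factor′
      S≡ : + S n k ≡ s * P^ m
      S≡ = proj₁ (proj₂ factor)
      S′≡ : + S (p N.* n) (p N.* k) ≡ s′ * P^ m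
      S′≡ = proj₁ (proj₂ factor′)
      V : ℤ
      V = + ε! k * c! ^ (k N.+ p N.* M)
      -- n + M = k + p·M, since (p-1)·M = n - k
      exponents : n N.+ M ≡ k N.+ p N.* M
      exponents = trans (cong (N._+ M) (sym (leading-M-spec n k m k≤n h))) (regroup (suc q) M k)
        where regroup : ∀ c M k → c N.* M N.+ k N.+ M ≡ k N.+ (M N.+ c N.* M)
              regroup = NS.solve-∀
      shift : c! ^ n * (+ ε! k * c! ^ M * s) ≡ V * s
      shift = trans (regroup (c! ^ n) (+ ε! k) (c! ^ M) s)
                    (cong (λ z → + ε! k * z * s) (trans (sym (^-distribˡ-+-* c! n M)) (cong (c! ^_) exponents)))
        where regroup : ∀ a b c d → a * (b * c * d) ≡ b * (a * c) * d
              regroup = solve-∀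
      s′≡s : Cg 1 s′ s
      s′≡s = cg-cancel V (unit-εc k (k N.+ p N.* M))
               (cg-trans (cg-sym (cg-*r s′ (unit-scale k M)))
                 (cg-trans (proj₂ (proj₂ factor′)) (cg-trans (count-scale n k) (cg-trans (cg-*l (c! ^ n) (cg-sym (proj₂ (proj₂ factor)))) (cg-≡ shift)))))

  S-scale : ∀ n k m → suc q N.* m N.+ σp n ≡ σp k → Cg (suc m) (+ S (p N.* n) (p N.* k)) (+ S n k)
  S-scale n k m h with k N.≤? n
  ... | yes k≤n = S-scale-leading n k m k≤n h
  ... | no k≰n = cg-≡ (cong +_ (trans (S-vanishes (p N.* k) (p N.* n) (NP.*-monoʳ-< p (NP.≰⇒> k≰n))) (sym (S-vanishes k n (NP.≰⇒> k≰n)))))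

module MinimumZero (q : ℕ) (pr : Prime (suc (suc q))) where

  open import Defs using (S; Val; ε; MinZero)
  open import Data.Nat as N using (ℕ; suc; _%_; _/_)
  import Data.Nat.Properties as NP
  open import Data.Nat.DivMod using (m*n/n≡m)
  import Data.Nat.Divisibility as ND
  open import Data.Integer hiding (suc; _%_; _/_)
  open import Data.Integer.Properties using (pos-+; pos-*; +-injective)
  open import Data.Integer.Tactic.RingSolver using (solve-∀)
  open import Data.Product using (∃; _×_; _,_; proj₁; proj₂)
  open import Relation.Nullary using (¬_)
  open import Relation.Binary.PropositionalEquality
  open StirlingScaling q pr public

  unit-part : ∀ X v (d : (p N.^ v) ND.∣ X) → ε p X v ≡ ND.quotient d
  unit-part X v d = trans (cong (λ z → (z / p N.^ v) {{NP.m^n≢0 p v}}) (ND.m∣n⇒n≡quotient*m d))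
                          (m*n/n≡m (ND.quotient d) (p N.^ v) {{NP.m^n≢0 p v}})

  scaled-unit : ∀ X v (d : (p N.^ v) ND.∣ X) → + X ≡ P^ v * + ND.quotient d
  scaled-unit X v d = trans (cong +_ (trans (ND.m∣n⇒n≡quotient*m d) (NP.*-comm _ (p N.^ v)))) (pos-* (p N.^ v) _)

  valuation-transfer : ∀ A B v → Cg (suc v) (+ A) (+ B) → Val p B v → Val p A v × ε p A v % p ≡ ε p B v % p
  valuation-transfer A B v A≡B (B≢0 , p^v∣B , p^v+1∤B) = (A≢0 , p^v∣A , p^v+1∤A) , units
    where
      p^v∣A : (p N.^ v) ND.∣ A
      p^v∣A = cg0⇒dvdℕ (cg-trans (cg-weak 1 A≡B) (cg-dvdℕ B p^v∣B))
      p^v+1∤A : ¬ (p N.^ suc v) ND.∣ A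
      p^v+1∤A p^v+1∣A = p^v+1∤B (cg0⇒dvdℕ (cg-trans (cg-sym A≡B) (cg-dvdℕ A p^v+1∣A)))
      A≢0 : A ≢ 0
      A≢0 refl = p^v+1∤A (ND._∣0 _)
      unit-congruence : Cg 1 (+ ND.quotient p^v∣A) (+ ND.quotient p^v∣B)
      unit-congruence = cg-unscale v (subst₂ (Cg (v N.+ 1)) (scaled-unit A v p^v∣A) (scaled-unit B v p^v∣B)
                                               (subst (λ z → Cg z (+ A) (+ B)) (NP.+-comm 1 v) A≡B))
      units : ε p A v % p ≡ ε p B v % p
      units = trans (cong (_% p) (unit-part A v p^v∣A))
                (trans (cg⇒%≡ _ _ unit-congruence) (cong (_% p) (sym (unit-part B v p^v∣B))))

  exponent-ℤ⇒ℕ : ∀ v a b → + (suc q) * + v ≡ + a - + b → suc q N.* v N.+ b ≡ a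
  exponent-ℤ⇒ℕ v a b e = +-injective (trans (pos-+ (suc q N.* v) b) (trans (cong (_+ + b) (trans (pos-* (suc q) v) e)) (cancel (+ a) (+ b))))
    where cancel : ∀ x y → x - y + y ≡ x
          cancel = solve-∀

  exponent-ℕ⇒ℤ : ∀ v a b → suc q N.* v N.+ b ≡ a → + (suc q) * + v ≡ + a - + b
  exponent-ℕ⇒ℤ v a b e = trans (sym (pos-* (suc q) v)) (trans (cancel (+ (suc q N.* v)) (+ b)) (cong (_- + b) (trans (sym (pos-+ (suc q N.* v) b)) (cong +_ e))))
    where cancel : ∀ x y → x ≡ x + y - y
          cancel = solve-∀

  σ-*p : ∀ m → σp (m N.* p) ≡ σp m
  σ-*p m = trans (cong σp (NP.*-comm m p)) (σ-p* m)

  exponent-scale : ∀ v n k → suc q N.* v N.+ σp (n N.* p) ≡ σp (k N.* p) → suc q N.* v N.+ σp n ≡ σp k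
  exponent-scale v n k e = trans (cong (suc q N.* v N.+_) (sym (σ-*p n))) (trans e (σ-*p k))

  -- S-scale with the factor p on the right, as in the statement.
  S-scale′ : ∀ n k v → suc q N.* v N.+ σp n ≡ σp k → Cg (suc v) (+ S (n N.* p) (k N.* p)) (+ S n k)
  S-scale′ n k v e = subst₂ (λ x y → Cg (suc v) (+ S x y) (+ S n k)) (NP.*-comm p n) (NP.*-comm p k) (S-scale n k v e)

  minZero-up : ∀ n k → MinZero p n k → MinZero p (n N.* p) (k N.* p)
  minZero-up n k (v , val , e) =
    v , proj₁ (valuation-transfer _ _ v (S-scale′ n k v (exponent-ℤ⇒ℕ v _ _ e)) val) ,
    subst₂ (λ x y → + (suc q) * + v ≡ + x - + y) (sym (σ-*p k)) (sym (σ-*p n)) e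

  minZero-down : ∀ n k → MinZero p (n N.* p) (k N.* p) → MinZero p n k
  minZero-down n k (v , val , e) =
    v , proj₁ (valuation-transfer _ _ v (cg-sym (S-scale′ n k v e′)) val) , exponent-ℕ⇒ℤ v _ _ e′
    where e′ : suc q N.* v N.+ σp n ≡ σp k
          e′ = exponent-scale v n k (exponent-ℤ⇒ℕ v _ _ e)

  minZero-units : ∀ n k → MinZero p n k →
                  ∃ λ v → Val p (S n k) v × Val p (S (n N.* p) (k N.* p)) v
                          × ε p (S n k) v % p ≡ ε p (S (n N.* p) (k N.* p)) v % p
  minZero-units n k (v , val , e) = v , val , proj₁ transfer , sym (proj₂ transfer)
    where transfer : Val p (S (n N.* p) (k N.* p)) v × ε p (S (n N.* p) (k N.* p)) v % p ≡ ε p (S n k) v % p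
          transfer = valuation-transfer _ _ v (S-scale′ n k v (exponent-ℤ⇒ℕ v _ _ e)) val

open import Defs using (S; Val; ε; MinZero)
open import Data.Nat using (zero; _*_; _%_; NonZero)
open import Data.Nat.Primality using (¬prime[0]; ¬prime[1])
open import Data.Product using (_×_; ∃; _,_)
open import Data.Empty using (⊥-elim)
open import Function.Bundles using (_⇔_; mk⇔)
open import Relation.Binary.PropositionalEquality using (_≡_)

corollary2p1 : (p : ℕ) → .{{_ : NonZero p}} → Prime p → (n k : ℕ) → .{{_ : NonZero n}} → .{{_ : NonZero k}} →
    (MinZero p n k ⇔ MinZero p (n * p) (k * p))
    × (MinZero p n k → ∃ λ v → Val p (S n k) v × Val p (S (n * p) (k * p)) v
         × ε p (S n k) v % p ≡ ε p (S (n * p) (k * p)) v % p)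
corollary2p1 zero          pr n k = ⊥-elim (¬prime[0] pr)
corollary2p1 (suc zero)    pr n k = ⊥-elim (¬prime[1] pr)
corollary2p1 (suc (suc q)) pr n k = mk⇔ (minZero-up n k) (minZero-down n k) , minZero-units n k
  where open MinimumZero q pr
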